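{- Let $a,b\geq 2$ be integers, let $n=a+b-1$, $V=\{1,2,\dots,n\}$, and consider the permutations $\alpha=(1\ 2\ \dots\ a)$ and $\beta=(a\ a+1\ \dots\ n)$ of $V$ (the 1-connected $(a,b)$-puzzle). The configuration group generated by $\alpha$ and $\beta$ is the alternating group $A_n$ if both $a$ and $b$ are odd, and it is the symmetric group $S_n$ otherwise. Moreover, every permutation in the configuration group can be generated in $O(n^2)$ shifts.
   Context: A cyclic shift puzzle is given by a set $V=\{1,\dots,n\}$ and a set of cycles (cyclic permutations) on $V$; a "shift" along a cycle $\gamma$ consists of composing the current permutation (token placement) with $\gamma$ or $\gamma^{ -1}$. The configuration group is the subgroup of $S_n$ generated by the given cycles. "A permutation $\pi$ can be generated in $N$ shifts" means $\pi$ can be written as a product of at most $N$ factors, each of which is one of the given cycles or its inverse; the $O(\cdot)$ bound is uniform over all $a,b$ and all permutations in the group. -}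

module Defs where

open import Data.Nat as ℕ using (ℕ; zero; suc; _+_; _*_; _∸_; _≤_; _<_; s≤s; z≤n)
open import Data.Nat.Properties as ℕP using (_≤?_; _<?_; _≟_; ≤-<-trans; <-≤-trans; ≤-trans)
open import Data.Fin as F using (Fin; toℕ; fromℕ<)
open import Data.Fin.Properties as FP using (toℕ<n)
open import Data.Fin.Properties using () renaming (_<?_ to _<?F_)
open import Data.Fin.Permutation using (Permutation′; _⟨$⟩ʳ_)
open import Data.List using (List; []; _∷_; length; map; allFin)
open import Data.Nat.ListAction using (sum)
open import Data.Nat.Divisibility using (_∣_)
open import Data.Bool using (Bool; true; false; _∧_; if_then_else_)
open import Relation.Nullary using (yes; no; does)
open import Function using (_∘_; id)
open import Data.Product using (Σ; _×_)
open import Relation.Binary.PropositionalEquality using (_≡_)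

-- V = {1,…,n} is represented by Fin n: the point k ∈ V is the element k - 1.

private
  pred<self : ∀ {m k} → m < k → ℕ.pred k < k
  pred<self {k = suc k} _ = ℕP.≤-refl

cycUp : {n : ℕ} (lo hi : ℕ) → hi ≤ n → Fin n → Fin n
cycUp {n} lo hi p i with lo ≤? toℕ i
... | no _ = i
... | yes lo≤i with suc (toℕ i) <? hi
...   | yes si<hi = fromℕ< (<-≤-trans si<hi p)
...   | no _ with toℕ i <? hi
...     | yes _ = fromℕ< (≤-<-trans lo≤i (toℕ<n i))
...     | no _ = i

cycDown : {n : ℕ} (lo hi : ℕ) → hi ≤ n → Fin n → Fin n
cycDown {n} lo hi p i with toℕ i <? hi
... | no _ = i
... | yes i<hi with lo <? toℕ i
...   | yes _ = fromℕ< (≤-<-trans ℕP.pred[n]≤n (toℕ<n i))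
...   | no _ with lo ≟ toℕ i
...     | yes _ = fromℕ< (<-≤-trans (pred<self i<hi) p)
...     | no _ = i

data Move : Set where
  α⁺ α⁻ β⁺ β⁻ : Move

private
  a≤n : ∀ a b → 2 ≤ b → a ≤ a + b ∸ 1
  a≤n a (suc zero) (s≤s ())
  a≤n a (suc (suc b)) _ rewrite ℕP.+-suc a (suc b) = ℕP.m≤m+n a (suc b)

-- α = (1 2 … a)  (0-based block 0 … a-1),
-- β = (a a+1 … n) (0-based block a-1 … n-1).
move : (a b : ℕ) → 2 ≤ b → Move → Fin (a + b ∸ 1) → Fin (a + b ∸ 1)
move a b hb α⁺ = cycUp 0 a (a≤n a b hb)
move a b hb α⁻ = cycDown 0 a (a≤n a b hb)
move a b hb β⁺ = cycUp (a ∸ 1) (a + b ∸ 1) ℕP.≤-refl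
move a b hb β⁻ = cycDown (a ∸ 1) (a + b ∸ 1) ℕP.≤-refl

evalWord : (a b : ℕ) → 2 ≤ b → List Move → Fin (a + b ∸ 1) → Fin (a + b ∸ 1)
evalWord a b hb []       = id
evalWord a b hb (m ∷ ms) = move a b hb m ∘ evalWord a b hb ms

GenIn : (a b : ℕ) → 2 ≤ b → ℕ → Permutation′ (a + b ∸ 1) → Set
GenIn a b hb N π =
  Σ (List Move) λ w → (length w ≤ N) × (∀ i → evalWord a b hb w i ≡ π ⟨$⟩ʳ i)

InGroup : (a b : ℕ) → 2 ≤ b → Permutation′ (a + b ∸ 1) → Set
InGroup a b hb π = Σ ℕ λ N → GenIn a b hb N π

inversions : {n : ℕ} → Permutation′ n → ℕ
inversions {n} π =
  sum (map (λ i → sum (map (λ j →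
    if does (i <?F j) ∧ does ((π ⟨$⟩ʳ j) <?F (π ⟨$⟩ʳ i)) then 1 else 0)
    (allFin n))) (allFin n))

IsEven : {n : ℕ} → Permutation′ n → Set
IsEven π = 2 ∣ inversions π

Odd : ℕ → Set
Odd m = 2 ∣ suc m

-- Both generators are cycles, and a cycle of length ℓ is a product of ℓ - 1 adjacent
-- transpositions, each of which changes the parity of the number of inversions; so if a and b
-- are odd, every word in α and β gives an even permutation.
-- Conversely, σ = αβ is the n-cycle and the commutator βα⁻¹β⁻¹α is a 3-cycle on three
-- consecutive points. Conjugates of it by σ², σ⁴, … multiply to any cycle of odd length on a
-- block of consecutive points, and pulling the common conjugation by a power of σ out of the
-- product makes this a word of length O(n). An even permutation is sorted one position at a
-- time: the value j due at position i is moved there by the odd cycle on [i, j] when j - i is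
-- even, and by the odd cycle on [i + 1, j] followed by an inverse 3-cycle when j - i is odd.
-- Once all but the last two positions are sorted, evenness forces the last two as well, so
-- O(n) words of length O(n) suffice. If a or b is even, the corresponding generator is odd, and
-- one extra shift turns an odd permutation into an even one.

module Submission where

open import Defs
open import Data.Nat using (ℕ; zero; suc; pred; _+_; _*_; _∸_; _≤_; _<_; s≤s; z≤n; _<ᵇ_; _≡ᵇ_; >-nonZero)
open import Data.Nat.Properties
open import Data.Nat.ListAction using (sum)
open import Data.Nat.Divisibility using (_∣_; divides; _∣?_)
open import Data.Nat.Tactic.RingSolver using (solve-∀)
open import Data.Bool using (Bool; true; false; not; _∧_; _xor_; if_then_else_)
open import Data.Bool.Properties
  using ( not-involutive; not-distribˡ-xor; not-distribʳ-xor; ∧-zeroʳ; ∧-identityʳ; ∧-distribˡ-xor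
        ; xor-identityʳ; xor-same; xor-∧-commutativeRing)
open import Algebra.Bundles using (CommutativeRing)
import Algebra.Properties.CommutativeMonoid.Sum as MonoidSum
open import Data.Fin as Fin using (Fin; zero; suc; toℕ; fromℕ<)
open import Data.Fin.Properties using (toℕ-fromℕ<; toℕ-injective; toℕ<n)
open import Data.Fin.Permutation using (Permutation′; _⟨$⟩ʳ_; _⟨$⟩ˡ_; inverseʳ; inverseˡ)
open import Data.List using (List; []; _∷_; _++_; length; map; allFin; tabulate)
open import Data.List.Properties using (length-++; map-tabulate)
open import Data.Product using (Σ; _×_; _,_; proj₂)
open import Data.Sum using (_⊎_; inj₁; inj₂)
open import Data.Empty using (⊥-elim)
open import Function using (_∘_; id)
open import Relation.Nullary using (yes; no; ¬_; does)
open import Relation.Nullary.Decidable using (dec-true; dec-false)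
open import Relation.Binary using (tri<; tri≈; tri>)
open import Relation.Binary.PropositionalEquality

open MonoidSum (CommutativeRing.+-commutativeMonoid xor-∧-commutativeRing)
  using (sum-syntax; sum-cong-≗; ∑-distrib-+; sum-replicate-zero)

-- Cycles on a block of consecutive numbers

data Rotate⁺Case (lo hi x : ℕ) : Set where
  below : x < lo → Rotate⁺Case lo hi x
  inner : lo ≤ x → suc x < hi → Rotate⁺Case lo hi x
  last  : lo ≤ x → suc x ≡ hi → Rotate⁺Case lo hi x
  above : hi ≤ x → Rotate⁺Case lo hi x

rotate⁺-case : ∀ lo hi x → Rotate⁺Case lo hi x
rotate⁺-case lo hi x with x <? lo
... | yes x<lo = below x<lo
... | no x≮lo with <-cmp (suc x) hi
... | tri< x+1<hi _ _ = inner (≮⇒≥ x≮lo) x+1<hi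
... | tri≈ _ x+1≡hi _ = last (≮⇒≥ x≮lo) x+1≡hi
... | tri> _ _ hi<x+1 = above (≤-pred hi<x+1)

data Rotate⁻Case (lo hi x : ℕ) : Set where
  below : x < lo → Rotate⁻Case lo hi x
  first : x ≡ lo → x < hi → Rotate⁻Case lo hi x
  inner : lo < x → x < hi → Rotate⁻Case lo hi x
  above : hi ≤ x → Rotate⁻Case lo hi x

rotate⁻-case : ∀ lo hi x → Rotate⁻Case lo hi x
rotate⁻-case lo hi x with x <? hi
... | no x≮hi = above (≮⇒≥ x≮hi)
... | yes x<hi with <-cmp x lo
... | tri< x<lo _ _ = below x<lo
... | tri≈ _ x≡lo _ = first x≡lo x<hi
... | tri> _ _ lo<x = inner lo<x x<hi

-- The permutations cycUp lo hi and cycDown lo hi of Defs, read on ℕ.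
opaque
  rotate⁺ : ℕ → ℕ → ℕ → ℕ
  rotate⁺ lo hi x with rotate⁺-case lo hi x
  ... | below _ = x
  ... | inner _ _ = suc x
  ... | last _ _ = lo
  ... | above _ = x

  rotate⁻ : ℕ → ℕ → ℕ → ℕ
  rotate⁻ lo hi x with rotate⁻-case lo hi x
  ... | below _ = x
  ... | first _ _ = pred hi
  ... | inner _ _ = pred x
  ... | above _ = x

  rotate⁺-below : ∀ {lo hi x} → x < lo → rotate⁺ lo hi x ≡ x
  rotate⁺-below {lo} {hi} {x} x<lo with rotate⁺-case lo hi x
  ... | below _ = refl
  ... | inner lo≤x _ = ⊥-elim (<⇒≱ x<lo lo≤x)
  ... | last lo≤x _ = ⊥-elim (<⇒≱ x<lo lo≤x)
  ... | above _ = refl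

  rotate⁺-inner : ∀ {lo hi x} → lo ≤ x → suc x < hi → rotate⁺ lo hi x ≡ suc x
  rotate⁺-inner {lo} {hi} {x} lo≤x x+1<hi with rotate⁺-case lo hi x
  ... | below x<lo = ⊥-elim (<⇒≱ x<lo lo≤x)
  ... | inner _ _ = refl
  ... | last _ x+1≡hi = ⊥-elim (<-irrefl x+1≡hi x+1<hi)
  ... | above hi≤x = ⊥-elim (<⇒≱ (<-trans (n<1+n x) x+1<hi) hi≤x)

  rotate⁺-last : ∀ {lo hi x} → lo ≤ x → suc x ≡ hi → rotate⁺ lo hi x ≡ lo
  rotate⁺-last {lo} {hi} {x} lo≤x x+1≡hi with rotate⁺-case lo hi x
  ... | below x<lo = ⊥-elim (<⇒≱ x<lo lo≤x)
  ... | inner _ x+1<hi = ⊥-elim (<-irrefl x+1≡hi x+1<hi)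
  ... | last _ _ = refl
  ... | above hi≤x = ⊥-elim (<⇒≱ (subst (x <_) x+1≡hi (n<1+n x)) hi≤x)

  rotate⁺-above : ∀ {lo hi x} → hi ≤ x → rotate⁺ lo hi x ≡ x
  rotate⁺-above {lo} {hi} {x} hi≤x with rotate⁺-case lo hi x
  ... | below _ = refl
  ... | inner _ x+1<hi = ⊥-elim (<⇒≱ (<-trans (n<1+n x) x+1<hi) hi≤x)
  ... | last _ x+1≡hi = ⊥-elim (<⇒≱ (subst (x <_) x+1≡hi (n<1+n x)) hi≤x)
  ... | above _ = refl

  rotate⁻-below : ∀ {lo hi x} → x < lo → rotate⁻ lo hi x ≡ x
  rotate⁻-below {lo} {hi} {x} x<lo with rotate⁻-case lo hi x
  ... | below _ = refl
  ... | first x≡lo _ = ⊥-elim (<-irrefl x≡lo x<lo)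
  ... | inner lo<x _ = ⊥-elim (<-asym x<lo lo<x)
  ... | above _ = refl

  rotate⁻-first : ∀ {lo hi x} → x ≡ lo → x < hi → rotate⁻ lo hi x ≡ pred hi
  rotate⁻-first {lo} {hi} {x} x≡lo x<hi with rotate⁻-case lo hi x
  ... | below x<lo = ⊥-elim (<-irrefl x≡lo x<lo)
  ... | first _ _ = refl
  ... | inner lo<x _ = ⊥-elim (<-irrefl (sym x≡lo) lo<x)
  ... | above hi≤x = ⊥-elim (<⇒≱ x<hi hi≤x)

  rotate⁻-inner : ∀ {lo hi x} → lo < x → x < hi → rotate⁻ lo hi x ≡ pred x
  rotate⁻-inner {lo} {hi} {x} lo<x x<hi with rotate⁻-case lo hi x
  ... | below x<lo = ⊥-elim (<-asym x<lo lo<x)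
  ... | first x≡lo _ = ⊥-elim (<-irrefl (sym x≡lo) lo<x)
  ... | inner _ _ = refl
  ... | above hi≤x = ⊥-elim (<⇒≱ x<hi hi≤x)

  rotate⁻-above : ∀ {lo hi x} → hi ≤ x → rotate⁻ lo hi x ≡ x
  rotate⁻-above {lo} {hi} {x} hi≤x with rotate⁻-case lo hi x
  ... | below _ = refl
  ... | first _ x<hi = ⊥-elim (<⇒≱ x<hi hi≤x)
  ... | inner _ x<hi = ⊥-elim (<⇒≱ x<hi hi≤x)
  ... | above _ = refl

module _ {n : ℕ} (lo hi : ℕ) (hi≤n : hi ≤ n) (i : Fin n) where

  cycUp-below : toℕ i < lo → toℕ (cycUp lo hi hi≤n i) ≡ toℕ i
  cycUp-below i<lo with lo ≤? toℕ i
  ... | no _ = refl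
  ... | yes lo≤i = ⊥-elim (<⇒≱ i<lo lo≤i)

  cycUp-inner : lo ≤ toℕ i → suc (toℕ i) < hi → toℕ (cycUp lo hi hi≤n i) ≡ suc (toℕ i)
  cycUp-inner lo≤i i+1<hi with lo ≤? toℕ i
  ... | no lo≰i = ⊥-elim (lo≰i lo≤i)
  ... | yes _ with suc (toℕ i) <? hi
  ... | yes _ = toℕ-fromℕ< _
  ... | no i+1≮hi = ⊥-elim (i+1≮hi i+1<hi)

  cycUp-last : lo ≤ toℕ i → suc (toℕ i) ≡ hi → toℕ (cycUp lo hi hi≤n i) ≡ lo
  cycUp-last lo≤i i+1≡hi with lo ≤? toℕ i
  ... | no lo≰i = ⊥-elim (lo≰i lo≤i)
  ... | yes _ with suc (toℕ i) <? hi
  ... | yes i+1<hi = ⊥-elim (<-irrefl i+1≡hi i+1<hi)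
  ... | no _ with toℕ i <? hi
  ... | yes _ = toℕ-fromℕ< _
  ... | no i≮hi = ⊥-elim (i≮hi (subst (toℕ i <_) i+1≡hi (n<1+n _)))

  cycUp-above : hi ≤ toℕ i → toℕ (cycUp lo hi hi≤n i) ≡ toℕ i
  cycUp-above hi≤i with lo ≤? toℕ i
  ... | no _ = refl
  ... | yes _ with suc (toℕ i) <? hi
  ... | yes i+1<hi = ⊥-elim (<⇒≱ (<-trans (n<1+n _) i+1<hi) hi≤i)
  ... | no _ with toℕ i <? hi
  ... | yes i<hi = ⊥-elim (<⇒≱ i<hi hi≤i)
  ... | no _ = refl

  cycDown-below : toℕ i < lo → toℕ (cycDown lo hi hi≤n i) ≡ toℕ i
  cycDown-below i<lo with toℕ i <? hi
  ... | no _ = refl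
  ... | yes _ with lo <? toℕ i
  ... | yes lo<i = ⊥-elim (<-asym i<lo lo<i)
  ... | no _ with lo ≟ toℕ i
  ... | yes lo≡i = ⊥-elim (<-irrefl (sym lo≡i) i<lo)
  ... | no _ = refl

  cycDown-first : toℕ i ≡ lo → toℕ i < hi → toℕ (cycDown lo hi hi≤n i) ≡ pred hi
  cycDown-first i≡lo i<hi with toℕ i <? hi
  ... | no i≮hi = ⊥-elim (i≮hi i<hi)
  ... | yes _ with lo <? toℕ i
  ... | yes lo<i = ⊥-elim (<-irrefl (sym i≡lo) lo<i)
  ... | no _ with lo ≟ toℕ i
  ... | yes _ = toℕ-fromℕ< _
  ... | no lo≢i = ⊥-elim (lo≢i (sym i≡lo))

  cycDown-inner : lo < toℕ i → toℕ i < hi → toℕ (cycDown lo hi hi≤n i) ≡ pred (toℕ i)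
  cycDown-inner lo<i i<hi with toℕ i <? hi
  ... | no i≮hi = ⊥-elim (i≮hi i<hi)
  ... | yes _ with lo <? toℕ i
  ... | yes _ = toℕ-fromℕ< _
  ... | no lo≮i = ⊥-elim (lo≮i lo<i)

  cycDown-above : hi ≤ toℕ i → toℕ (cycDown lo hi hi≤n i) ≡ toℕ i
  cycDown-above hi≤i with toℕ i <? hi
  ... | no _ = refl
  ... | yes i<hi = ⊥-elim (<⇒≱ i<hi hi≤i)

  toℕ-cycUp : toℕ (cycUp lo hi hi≤n i) ≡ rotate⁺ lo hi (toℕ i)
  toℕ-cycUp with rotate⁺-case lo hi (toℕ i)
  ... | below p   = trans (cycUp-below p) (sym (rotate⁺-below p))
  ... | inner p q = trans (cycUp-inner p q) (sym (rotate⁺-inner p q))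
  ... | last p q  = trans (cycUp-last p q) (sym (rotate⁺-last p q))
  ... | above p   = trans (cycUp-above p) (sym (rotate⁺-above p))

  toℕ-cycDown : toℕ (cycDown lo hi hi≤n i) ≡ rotate⁻ lo hi (toℕ i)
  toℕ-cycDown with rotate⁻-case lo hi (toℕ i)
  ... | below p   = trans (cycDown-below p) (sym (rotate⁻-below p))
  ... | first p q = trans (cycDown-first p q) (sym (rotate⁻-first p q))
  ... | inner p q = trans (cycDown-inner p q) (sym (rotate⁻-inner p q))
  ... | above p   = trans (cycDown-above p) (sym (rotate⁻-above p))

rotate⁻-rotate⁺ : ∀ lo hi x → rotate⁻ lo hi (rotate⁺ lo hi x) ≡ x
rotate⁻-rotate⁺ lo hi x with rotate⁺-case lo hi x
... | below x<lo rewrite rotate⁺-below {lo} {hi} x<lo = rotate⁻-below x<lo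
... | inner lo≤x x+1<hi rewrite rotate⁺-inner {lo} {hi} lo≤x x+1<hi = rotate⁻-inner (s≤s lo≤x) x+1<hi
... | last lo≤x refl rewrite rotate⁺-last {lo} {suc x} lo≤x refl = rotate⁻-first refl (s≤s lo≤x)
... | above hi≤x rewrite rotate⁺-above {lo} {hi} hi≤x = rotate⁻-above hi≤x

rotate⁺-rotate⁻ : ∀ lo hi x → rotate⁺ lo hi (rotate⁻ lo hi x) ≡ x
rotate⁺-rotate⁻ lo hi x with rotate⁻-case lo hi x
... | below x<lo rewrite rotate⁻-below {lo} {hi} x<lo = rotate⁺-below x<lo
... | first refl (s≤s x≤h) rewrite rotate⁻-first {x} {suc _} refl (s≤s x≤h) = rotate⁺-last x≤h refl
... | inner lo<x@(s≤s lo≤y) x<hi rewrite rotate⁻-inner {lo} {hi} lo<x x<hi = rotate⁺-inner lo≤y x<hi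
... | above hi≤x rewrite rotate⁻-above {lo} {hi} hi≤x = rotate⁺-above hi≤x

rotate⁺-trivial : ∀ lo x → rotate⁺ lo (suc lo) x ≡ x
rotate⁺-trivial lo x with rotate⁺-case lo (suc lo) x
... | below x<lo = rotate⁺-below x<lo
... | inner lo≤x (s≤s x<lo) = ⊥-elim (<⇒≱ x<lo lo≤x)
... | last lo≤x refl = rotate⁺-last lo≤x refl
... | above lo<x = rotate⁺-above lo<x

rotate⁺-split : ∀ {L M H} x → L ≤ M → M < H → rotate⁺ L H x ≡ rotate⁺ L (suc M) (rotate⁺ M H x)
rotate⁺-split {L} {M} {H} x L≤M M<H with rotate⁺-case M H x
... | below x<M with L ≤? x
...   | no L≰x rewrite rotate⁺-below {M} {H} x<M
        = trans (rotate⁺-below (≰⇒> L≰x)) (sym (rotate⁺-below (≰⇒> L≰x)))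
...   | yes L≤x rewrite rotate⁺-below {M} {H} x<M
        = trans (rotate⁺-inner L≤x (≤-<-trans x<M M<H)) (sym (rotate⁺-inner L≤x (s≤s x<M)))
rotate⁺-split {L} {M} {H} x L≤M M<H | inner M≤x x+1<H rewrite rotate⁺-inner {M} {H} M≤x x+1<H
  = trans (rotate⁺-inner (≤-trans L≤M M≤x) x+1<H) (sym (rotate⁺-above (s≤s M≤x)))
rotate⁺-split {L} {M} {H} x L≤M M<H | last M≤x x+1≡H rewrite rotate⁺-last {M} {H} M≤x x+1≡H
  = trans (rotate⁺-last (≤-trans L≤M M≤x) x+1≡H) (sym (rotate⁺-last L≤M refl))
rotate⁺-split {L} {M} {H} x L≤M M<H | above H≤x rewrite rotate⁺-above {M} {H} H≤x
  = trans (rotate⁺-above H≤x) (sym (rotate⁺-above (≤-trans M<H H≤x)))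

rotate⁺-full-shift : ∀ {lo hi n} x → hi < n → x < n →
  rotate⁺ 0 n (rotate⁺ lo hi x) ≡ rotate⁺ (suc lo) (suc hi) (rotate⁺ 0 n x)
rotate⁺-full-shift {lo} {hi} {n} x hi<n x<n with rotate⁺-case 0 n x
... | below ()
... | above n≤x = ⊥-elim (<⇒≱ x<n n≤x)
... | last _ x+1≡n
  rewrite rotate⁺-above {lo} {hi} (≤-pred (subst (hi <_) (sym x+1≡n) hi<n))
        | rotate⁺-last {0} {n} z≤n x+1≡n = sym (rotate⁺-below (s≤s z≤n))
... | inner _ x+1<n rewrite rotate⁺-inner {0} {n} z≤n x+1<n with rotate⁺-case lo hi x
...   | below x<lo rewrite rotate⁺-below {lo} {hi} x<lo =
        trans (rotate⁺-inner z≤n x+1<n) (sym (rotate⁺-below (s≤s x<lo)))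
...   | inner lo≤x x+1<hi rewrite rotate⁺-inner {lo} {hi} lo≤x x+1<hi =
        trans (rotate⁺-inner z≤n (≤-<-trans x+1<hi hi<n)) (sym (rotate⁺-inner (s≤s lo≤x) (s≤s x+1<hi)))
...   | last lo≤x x+1≡hi rewrite rotate⁺-last {lo} {hi} lo≤x x+1≡hi =
        trans (rotate⁺-inner z≤n (≤-<-trans (s≤s lo≤x) x+1<n)) (sym (rotate⁺-last (s≤s lo≤x) (cong suc x+1≡hi)))
...   | above hi≤x rewrite rotate⁺-above {lo} {hi} hi≤x =
        trans (rotate⁺-inner z≤n x+1<n) (sym (rotate⁺-above (s≤s hi≤x)))

rotate⁺-join : ∀ {m n} x → suc m ≤ n → x < n → rotate⁺ 0 (suc m) (rotate⁺ m n x) ≡ rotate⁺ 0 n x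
rotate⁺-join {m} {n} x m<n x<n with rotate⁺-case m n x
... | below x<m rewrite rotate⁺-below {m} {n} x<m =
  trans (rotate⁺-inner z≤n (s≤s x<m)) (sym (rotate⁺-inner z≤n (<-≤-trans (s≤s x<m) m<n)))
... | inner m≤x x+1<n rewrite rotate⁺-inner {m} {n} m≤x x+1<n =
  trans (rotate⁺-above (s≤s m≤x)) (sym (rotate⁺-inner z≤n x+1<n))
... | last m≤x x+1≡n rewrite rotate⁺-last {m} {n} m≤x x+1≡n =
  trans (rotate⁺-last z≤n refl) (sym (rotate⁺-last z≤n x+1≡n))
... | above n≤x = ⊥-elim (<⇒≱ x<n n≤x)

-- With α the cycle on [0, c + 2) and β the cycle on [c + 1, n), which overlap in the single
-- point c + 1, the commutator β α⁻¹ β⁻¹ α is the 3-cycle on [c, c + 3).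
rotate⁺-commutator : ∀ c {n} x → 3 + c ≤ n → x < n →
  rotate⁺ (suc c) n (rotate⁻ 0 (2 + c) (rotate⁻ (suc c) n (rotate⁺ 0 (2 + c) x))) ≡ rotate⁺ c (3 + c) x
rotate⁺-commutator c {zero} x () x<n
rotate⁺-commutator c {suc m} x (s≤s c+2≤m) x<n with <-cmp x c
... | tri< x<c _ _
  rewrite rotate⁺-inner {0} {2 + c} {x} z≤n (s≤s (m<n⇒m<1+n x<c))
        | rotate⁻-below {suc c} {suc m} {suc x} (s≤s x<c)
        | rotate⁻-inner {0} {2 + c} {suc x} (s≤s z≤n) (s≤s (m<n⇒m<1+n x<c))
        | rotate⁺-below {suc c} {suc m} {x} (m<n⇒m<1+n x<c)
        | rotate⁺-below {c} {3 + c} {x} x<c = refl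
... | tri≈ _ refl _
  rewrite rotate⁺-inner {0} {2 + c} {c} z≤n ≤-refl
        | rotate⁻-first {suc c} {suc m} {suc c} refl (≤-<-trans (n≤1+n _) (s≤s c+2≤m))
        | rotate⁻-above {0} {2 + c} {m} c+2≤m
        | rotate⁺-last {suc c} {suc m} {m} (≤-trans (n≤1+n _) c+2≤m) refl
        | rotate⁺-inner {c} {3 + c} {c} ≤-refl (s≤s (s≤s (n≤1+n _))) = refl
... | tri> _ _ c<x with <-cmp x (suc c)
...   | tri< x<c+1 _ _ = ⊥-elim (<⇒≱ x<c+1 c<x)
...   | tri≈ _ refl _
  rewrite rotate⁺-last {0} {2 + c} {suc c} z≤n refl
        | rotate⁻-below {suc c} {suc m} {0} (s≤s z≤n)
        | rotate⁻-first {0} {2 + c} {0} refl (s≤s z≤n)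
        | rotate⁺-inner {suc c} {suc m} {suc c} ≤-refl (s≤s c+2≤m)
        | rotate⁺-inner {c} {3 + c} {suc c} (n≤1+n _) ≤-refl = refl
...   | tri> _ _ c+1<x with <-cmp x (2 + c)
...     | tri< x<c+2 _ _ = ⊥-elim (<⇒≱ x<c+2 c+1<x)
...     | tri≈ _ refl _
  rewrite rotate⁺-above {0} {2 + c} {2 + c} ≤-refl
        | rotate⁻-inner {suc c} {suc m} {2 + c} ≤-refl (s≤s c+2≤m)
        | rotate⁻-inner {0} {2 + c} {suc c} (s≤s z≤n) ≤-refl
        | rotate⁺-below {suc c} {suc m} {c} ≤-refl
        | rotate⁺-last {c} {3 + c} {2 + c} (≤-trans (n≤1+n _) (n≤1+n _)) refl = refl
...     | tri> _ _ c+2<x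
  rewrite rotate⁺-above {0} {2 + c} {x} (<⇒≤ c+2<x)
        | rotate⁻-inner {suc c} {suc m} {x} c+1<x x<n
        | rotate⁻-above {0} {2 + c} {pred x} (<⇒≤pred c+2<x)
        | rotate⁺-inner {suc c} {suc m} {pred x} (<⇒≤pred c+1<x)
            (subst (_< suc m) (sym (suc-pred x {{>-nonZero (≤-<-trans z≤n c+2<x)}})) x<n)
        | rotate⁺-above {c} {3 + c} {x} c+2<x
  = suc-pred x {{>-nonZero (≤-<-trans z≤n c+2<x)}}

-- Parity of the number of inversions

parity : ℕ → Bool
parity zero    = false
parity (suc n) = not (parity n)

parity-+ : ∀ m n → parity (m + n) ≡ parity m xor parity n
parity-+ zero    n = refl
parity-+ (suc m) n = trans (cong not (parity-+ m n)) (not-distribˡ-xor (parity m) (parity n))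

even⇒parity≡false : ∀ {m} → 2 ∣ m → parity m ≡ false
even⇒parity≡false (divides q refl) = parity-q*2 q
  where
  parity-q*2 : ∀ q → parity (q * 2) ≡ false
  parity-q*2 zero    = refl
  parity-q*2 (suc q) = trans (not-involutive _) (parity-q*2 q)

parity≡false⇒even : ∀ m → parity m ≡ false → 2 ∣ m
parity≡false⇒even zero          _ = divides 0 refl
parity≡false⇒even (suc zero)    ()
parity≡false⇒even (suc (suc m)) e with parity≡false⇒even m (trans (sym (not-involutive _)) e)
... | divides q refl = divides (suc q) refl

double : ℕ → ℕ
double zero    = zero
double (suc m) = suc (suc (double m))

halve : ∀ t → Σ ℕ λ m → t ≡ double m ⊎ t ≡ suc (double m)
halve zero          = 0 , inj₁ refl
halve (suc zero)    = 0 , inj₂ refl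
halve (suc (suc t)) with halve t
... | m , inj₁ t≡2m   = suc m , inj₁ (cong (2 +_) t≡2m)
... | m , inj₂ t≡2m+1 = suc m , inj₂ (cong (2 +_) t≡2m+1)

parity-double : ∀ m → parity (double m) ≡ false
parity-double zero    = refl
parity-double (suc m) = trans (not-involutive _) (parity-double m)

parity-sum-tabulate : ∀ {n} (f : Fin n → ℕ) → parity (sum (tabulate f)) ≡ ∑[ i < n ] parity (f i)
parity-sum-tabulate {zero}  f = refl
parity-sum-tabulate {suc n} f =
  trans (parity-+ (f zero) _) (cong (parity (f zero) xor_) (parity-sum-tabulate (f ∘ suc)))

parity-sum-allFin : ∀ {n} (f : Fin n → ℕ) → parity (sum (map f (allFin n))) ≡ ∑[ i < n ] parity (f i)
parity-sum-allFin f = trans (cong (parity ∘ sum) (map-tabulate id f)) (parity-sum-tabulate f)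

∑-false : ∀ {n} {f : Fin n → Bool} → (∀ i → f i ≡ false) → (∑[ i < n ] f i) ≡ false
∑-false {n} f≗false = trans (sum-cong-≗ f≗false) (sum-replicate-zero n)

inverted : ∀ {n} → (Fin n → Fin n) → Fin n → Fin n → Bool
inverted h i j = (toℕ i <ᵇ toℕ j) ∧ (toℕ (h j) <ᵇ toℕ (h i))

inversionParity : ∀ {n} → (Fin n → Fin n) → Bool
inversionParity {n} h = ∑[ i < n ] ∑[ j < n ] inverted h i j

-- Fin's _<?_ unfolds to _<ᵇ_ on toℕ, so the summands of Defs.inversions are the indicators of inverted.
parity-inversions : ∀ {n} (π : Permutation′ n) → parity (inversions π) ≡ inversionParity (π ⟨$⟩ʳ_)
parity-inversions {n} π = begin
  parity (inversions π)
    ≡⟨ parity-sum-allFin (λ i → sum (map (indicator i) (allFin n))) ⟩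
  (∑[ i < n ] parity (sum (map (indicator i) (allFin n))))
    ≡⟨ sum-cong-≗ (λ i → parity-sum-allFin (indicator i)) ⟩
  (∑[ i < n ] ∑[ j < n ] parity (indicator i j))
    ≡⟨ sum-cong-≗ (λ i → sum-cong-≗ λ j → parity-indicator (inverted (π ⟨$⟩ʳ_) i j)) ⟩
  inversionParity (π ⟨$⟩ʳ_) ∎
  where
  open ≡-Reasoning
  indicator : Fin n → Fin n → ℕ
  indicator i j = if inverted (π ⟨$⟩ʳ_) i j then 1 else 0
  parity-indicator : ∀ b → parity (if b then 1 else 0) ≡ b
  parity-indicator true  = refl
  parity-indicator false = refl

inversionParity-cong : ∀ {n} {h h′ : Fin n → Fin n} → (∀ i → h i ≡ h′ i) → inversionParity h ≡ inversionParity h′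
inversionParity-cong h≗h′ = sum-cong-≗ λ i → sum-cong-≗ λ j →
  cong₂ (λ u v → (toℕ i <ᵇ toℕ j) ∧ (toℕ u <ᵇ toℕ v)) (h≗h′ j) (h≗h′ i)

inversionParity-id : ∀ {n} → inversionParity {n} id ≡ false
inversionParity-id {n} = ∑-false λ i → ∑-false {n} (no-inversion i)
  where
  no-inversion : ∀ i j → inverted id i j ≡ false
  no-inversion i j with <-cmp (toℕ i) (toℕ j)
  ... | tri< _ _ j≮i =
    trans (cong ((toℕ i <ᵇ toℕ j) ∧_) (dec-false (toℕ j <? toℕ i) j≮i)) (∧-zeroʳ _)
  ... | tri≈ i≮j _ _ = cong (_∧ (toℕ j <ᵇ toℕ i)) (dec-false (toℕ i <? toℕ j) i≮j)
  ... | tri> i≮j _ _ = cong (_∧ (toℕ j <ᵇ toℕ i)) (dec-false (toℕ i <? toℕ j) i≮j)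

data SwapCase (k u : ℕ) : Set where
  first  : u ≡ k → SwapCase k u
  second : u ≡ suc k → SwapCase k u
  other  : u ≢ k → u ≢ suc k → SwapCase k u

swap-case : ∀ k u → SwapCase k u
swap-case k u with u ≟ k | u ≟ suc k
... | yes u≡k | _         = first u≡k
... | no _    | yes u≡k+1 = second u≡k+1
... | no u≢k  | no u≢k+1  = other u≢k u≢k+1

module _ (k : ℕ) where

  private
    k<ᵇk : (k <ᵇ k) ≡ false
    k<ᵇk = dec-false (k <? k) (<-irrefl refl)

    k+1<ᵇk : (suc k <ᵇ k) ≡ false
    k+1<ᵇk = dec-false (suc k <? k) (λ k+1<k → <-asym k+1<k (n<1+n k))

    k<ᵇk+1 : (k <ᵇ suc k) ≡ true
    k<ᵇk+1 = dec-true (k <? suc k) (n<1+n k)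

    k≡ᵇk : (k ≡ᵇ k) ≡ true
    k≡ᵇk = dec-true (k ≟ k) refl

    k≡ᵇk+1 : (k ≡ᵇ suc k) ≡ false
    k≡ᵇk+1 = dec-false (k ≟ suc k) (λ k≡k+1 → <-irrefl k≡k+1 (n<1+n k))

    k+1≡ᵇk : (suc k ≡ᵇ k) ≡ false
    k+1≡ᵇk = dec-false (suc k ≟ k) (λ k+1≡k → <-irrefl (sym k+1≡k) (n<1+n k))

  swap-first : rotate⁺ k (2 + k) k ≡ suc k
  swap-first = rotate⁺-inner ≤-refl ≤-refl

  swap-second : rotate⁺ k (2 + k) (suc k) ≡ k
  swap-second = rotate⁺-last (n≤1+n k) refl

  swap-other : ∀ {u} → u ≢ k → u ≢ suc k → rotate⁺ k (2 + k) u ≡ u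
  swap-other {u} u≢k u≢k+1 with <-cmp u k
  ... | tri< u<k _ _ = rotate⁺-below u<k
  ... | tri≈ _ u≡k _ = ⊥-elim (u≢k u≡k)
  ... | tri> _ _ k<u with <-cmp u (suc k)
  ...   | tri< u<k+1 _ _ = ⊥-elim (<-irrefl refl (<-≤-trans u<k+1 k<u))
  ...   | tri≈ _ u≡k+1 _ = ⊥-elim (u≢k+1 u≡k+1)
  ...   | tri> _ _ k+1<u = rotate⁺-above k+1<u

  private
    <ᵇ-k-other : ∀ {u} → u ≢ k → (u <ᵇ k) ≡ (u <ᵇ suc k)
    <ᵇ-k-other {u} u≢k with <-cmp u k
    ... | tri< u<k _ _ = trans (dec-true (u <? k) u<k) (sym (dec-true (u <? suc k) (<-trans u<k (n<1+n k))))
    ... | tri≈ _ u≡k _ = ⊥-elim (u≢k u≡k)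
    ... | tri> u≮k _ k<u = trans (dec-false (u <? k) u≮k) (sym (dec-false (u <? suc k) (<⇒≱ k<u ∘ ≤-pred)))

    other-<ᵇ-k : ∀ {u} → u ≢ suc k → (k <ᵇ u) ≡ (suc k <ᵇ u)
    other-<ᵇ-k {u} u≢k+1 with <-cmp u (suc k)
    ... | tri< u<k+1 _ _ =
      trans (dec-false (k <? u) (<⇒≱ u<k+1)) (sym (dec-false (suc k <? u) (<⇒≱ (<-trans u<k+1 (n<1+n _)))))
    ... | tri≈ _ u≡k+1 _ = ⊥-elim (u≢k+1 u≡k+1)
    ... | tri> _ _ k+1<u = trans (dec-true (k <? u) (<-trans (n<1+n k) k+1<u)) (sym (dec-true (suc k <? u) k+1<u))

    ≡ᵇ-other : ∀ {u v} → u ≢ v → (u ≡ᵇ v) ≡ false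
    ≡ᵇ-other {u} {v} u≢v = dec-false (u ≟ v) u≢v

  swap-<ᵇ : ∀ u v → (rotate⁺ k (2 + k) u <ᵇ rotate⁺ k (2 + k) v) xor (u <ᵇ v)
                  ≡ ((u ≡ᵇ k) ∧ (v ≡ᵇ suc k)) xor ((u ≡ᵇ suc k) ∧ (v ≡ᵇ k))
  swap-<ᵇ u v with swap-case k u | swap-case k v
  ... | first refl | first refl rewrite swap-first | k<ᵇk | k≡ᵇk | k≡ᵇk+1 = refl
  ... | first refl | second refl rewrite swap-first | swap-second | k+1<ᵇk | k<ᵇk+1 | k≡ᵇk | k≡ᵇk+1 = refl
  ... | first refl | other v≢k v≢k+1
    rewrite swap-first | swap-other v≢k v≢k+1 | other-<ᵇ-k v≢k+1 | xor-same (suc k <ᵇ v)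
          | k≡ᵇk | ≡ᵇ-other v≢k+1 | k≡ᵇk+1 = refl
  ... | second refl | first refl rewrite swap-first | swap-second | k+1<ᵇk | k<ᵇk+1 | k≡ᵇk | k+1≡ᵇk = refl
  ... | second refl | second refl rewrite swap-second | k<ᵇk | k+1≡ᵇk = sym (∧-zeroʳ (k ≡ᵇ k))
  ... | second refl | other v≢k v≢k+1
    rewrite swap-second | swap-other v≢k v≢k+1 | other-<ᵇ-k v≢k+1 | xor-same (suc k <ᵇ v)
          | k+1≡ᵇk | ≡ᵇ-other v≢k = sym (∧-zeroʳ (k ≡ᵇ k))
  ... | other u≢k u≢k+1 | first refl
    rewrite swap-first | swap-other u≢k u≢k+1 | <ᵇ-k-other u≢k | xor-same (u <ᵇ suc k)
          | ≡ᵇ-other u≢k | ≡ᵇ-other u≢k+1 = refl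
  ... | other u≢k u≢k+1 | second refl
    rewrite swap-second | swap-other u≢k u≢k+1 | <ᵇ-k-other u≢k | xor-same (u <ᵇ suc k)
          | ≡ᵇ-other u≢k | ≡ᵇ-other u≢k+1 = refl
  ... | other u≢k u≢k+1 | other v≢k v≢k+1
    rewrite swap-other u≢k u≢k+1 | swap-other v≢k v≢k+1 | xor-same (u <ᵇ v)
          | ≡ᵇ-other u≢k | ≡ᵇ-other u≢k+1 = refl

Invertible : ∀ {n} → (Fin n → Fin n) → Set
Invertible {n} h = Σ (Fin n → Fin n) λ g → (∀ x → h (g x) ≡ x) × (∀ x → g (h x) ≡ x)

module _ {n : ℕ} where

  invertible-injective : ∀ {h : Fin n → Fin n} → Invertible h → ∀ {i j} → h i ≡ h j → i ≡ j
  invertible-injective (g , _ , g∘h≗id) {i} {j} hi≡hj = trans (sym (g∘h≗id i)) (trans (cong g hi≡hj) (g∘h≗id j))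

  invertible-∘ : ∀ {f g : Fin n → Fin n} → Invertible f → Invertible g → Invertible (f ∘ g)
  invertible-∘ {f} {g} (f⁻¹ , f∘f⁻¹ , f⁻¹∘f) (g⁻¹ , g∘g⁻¹ , g⁻¹∘g) =
    g⁻¹ ∘ f⁻¹ ,
    (λ x → trans (cong f (g∘g⁻¹ (f⁻¹ x))) (f∘f⁻¹ x)) ,
    (λ x → trans (cong g⁻¹ (f⁻¹∘f (g x))) (g⁻¹∘g x))

  preimage : ∀ {h : Fin n → Fin n} → Invertible h → ∀ {k} → k < n → Σ (Fin n) λ p → toℕ (h p) ≡ k
  preimage (g , h∘g≗id , _) k<n = g (fromℕ< k<n) , trans (cong toℕ (h∘g≗id _)) (toℕ-fromℕ< k<n)

module _ {n : ℕ} (lo hi : ℕ) (hi≤n : hi ≤ n) where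

  cycUp-cycDown : ∀ x → cycUp lo hi hi≤n (cycDown lo hi hi≤n x) ≡ x
  cycUp-cycDown x = toℕ-injective (begin
    toℕ (cycUp lo hi hi≤n (cycDown lo hi hi≤n x)) ≡⟨ toℕ-cycUp lo hi hi≤n _ ⟩
    rotate⁺ lo hi (toℕ (cycDown lo hi hi≤n x))    ≡⟨ cong (rotate⁺ lo hi) (toℕ-cycDown lo hi hi≤n x) ⟩
    rotate⁺ lo hi (rotate⁻ lo hi (toℕ x))          ≡⟨ rotate⁺-rotate⁻ lo hi (toℕ x) ⟩
    toℕ x                                          ∎)
    where open ≡-Reasoning

  cycDown-cycUp : ∀ x → cycDown lo hi hi≤n (cycUp lo hi hi≤n x) ≡ x
  cycDown-cycUp x = toℕ-injective (begin
    toℕ (cycDown lo hi hi≤n (cycUp lo hi hi≤n x)) ≡⟨ toℕ-cycDown lo hi hi≤n _ ⟩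
    rotate⁻ lo hi (toℕ (cycUp lo hi hi≤n x))      ≡⟨ cong (rotate⁻ lo hi) (toℕ-cycUp lo hi hi≤n x) ⟩
    rotate⁻ lo hi (rotate⁺ lo hi (toℕ x))          ≡⟨ rotate⁻-rotate⁺ lo hi (toℕ x) ⟩
    toℕ x                                          ∎)
    where open ≡-Reasoning

  cycUp-invertible : Invertible (cycUp lo hi hi≤n)
  cycUp-invertible = cycDown lo hi hi≤n , cycUp-cycDown , cycDown-cycUp

  cycDown-invertible : Invertible (cycDown lo hi hi≤n)
  cycDown-invertible = cycUp lo hi hi≤n , cycDown-cycUp , cycUp-cycDown

_=ᵇ_ : ∀ {n} → Fin n → Fin n → Bool
i =ᵇ j = does (i Fin.≟ j)

≡ᵇ-preimage : ∀ {n} {h : Fin n → Fin n} → (∀ {i j} → h i ≡ h j → i ≡ j) →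
  ∀ {p k} → toℕ (h p) ≡ k → ∀ j → (toℕ (h j) ≡ᵇ k) ≡ (j =ᵇ p)
≡ᵇ-preimage {h = h} h-inj {p} refl j with j Fin.≟ p
... | yes refl = dec-true (toℕ (h p) ≟ toℕ (h p)) refl
... | no j≢p   = dec-false (toℕ (h j) ≟ toℕ (h p)) (j≢p ∘ h-inj ∘ toℕ-injective)

∑-point : ∀ {n} (p : Fin n) (f : Fin n → Bool) → (∑[ j < n ] ((j =ᵇ p) ∧ f j)) ≡ f p
∑-point {suc n} zero    f = trans (cong (f zero xor_) (∑-false {n} λ _ → refl)) (xor-identityʳ _)
∑-point {suc n} (suc p) f = ∑-point p (f ∘ suc)

module _ {n : ℕ} {h : Fin n → Fin n} (h-inj : ∀ {i j} → h i ≡ h j → i ≡ j)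
         {k : ℕ} (k+2≤n : 2 + k ≤ n) {p q : Fin n} (hp : toℕ (h p) ≡ k) (hq : toℕ (h q) ≡ suc k) where

  private
    swap : Fin n → Fin n
    swap = cycUp k (2 + k) k+2≤n

    _<ᶠ_ : Fin n → Fin n → Bool
    i <ᶠ j = toℕ i <ᵇ toℕ j

    regroup : ∀ a b c d e → a ∧ ((b ∧ c) xor (d ∧ e)) ≡ (b ∧ (c ∧ a)) xor (d ∧ (e ∧ a))
    regroup true  b c d e rewrite ∧-identityʳ c | ∧-identityʳ e = refl
    regroup false b c d e rewrite ∧-zeroʳ c | ∧-zeroʳ e | ∧-zeroʳ b | ∧-zeroʳ d = refl

  inverted-swap : ∀ i j → inverted (swap ∘ h) i j xor inverted h i j
                ≡ ((j =ᵇ p) ∧ ((i =ᵇ q) ∧ (i <ᶠ j))) xor ((j =ᵇ q) ∧ ((i =ᵇ p) ∧ (i <ᶠ j)))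
  inverted-swap i j = begin
    inverted (swap ∘ h) i j xor inverted h i j
      ≡⟨ ∧-distribˡ-xor (i <ᶠ j) _ _ ⟨
    (i <ᶠ j) ∧ ((toℕ (swap (h j)) <ᵇ toℕ (swap (h i))) xor (toℕ (h j) <ᵇ toℕ (h i)))
      ≡⟨ cong (λ t → (i <ᶠ j) ∧ (t xor (toℕ (h j) <ᵇ toℕ (h i))))
              (cong₂ _<ᵇ_ (toℕ-cycUp k (2 + k) k+2≤n (h j)) (toℕ-cycUp k (2 + k) k+2≤n (h i))) ⟩
    (i <ᶠ j) ∧ ((rotate⁺ k (2 + k) (toℕ (h j)) <ᵇ rotate⁺ k (2 + k) (toℕ (h i))) xor (toℕ (h j) <ᵇ toℕ (h i)))
      ≡⟨ cong ((i <ᶠ j) ∧_) (swap-<ᵇ k (toℕ (h j)) (toℕ (h i))) ⟩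
    (i <ᶠ j) ∧ (((toℕ (h j) ≡ᵇ k) ∧ (toℕ (h i) ≡ᵇ suc k)) xor ((toℕ (h j) ≡ᵇ suc k) ∧ (toℕ (h i) ≡ᵇ k)))
      ≡⟨ cong ((i <ᶠ j) ∧_) (cong₂ _xor_ (cong₂ _∧_ (≡ᵇ-preimage h-inj hp j) (≡ᵇ-preimage h-inj hq i))
                                          (cong₂ _∧_ (≡ᵇ-preimage h-inj hq j) (≡ᵇ-preimage h-inj hp i))) ⟩
    (i <ᶠ j) ∧ (((j =ᵇ p) ∧ (i =ᵇ q)) xor ((j =ᵇ q) ∧ (i =ᵇ p)))
      ≡⟨ regroup (i <ᶠ j) (j =ᵇ p) (i =ᵇ q) (j =ᵇ q) (i =ᵇ p) ⟩
    ((j =ᵇ p) ∧ ((i =ᵇ q) ∧ (i <ᶠ j))) xor ((j =ᵇ q) ∧ ((i =ᵇ p) ∧ (i <ᶠ j))) ∎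
    where open ≡-Reasoning

  inversionParity-swap : inversionParity (swap ∘ h) ≡ not (inversionParity h)
  inversionParity-swap = xor≡true⇒≡not (begin
    inversionParity (swap ∘ h) xor inversionParity h
      ≡⟨ ∑-distrib-+ (λ i → ∑[ j < n ] inverted (swap ∘ h) i j) (λ i → ∑[ j < n ] inverted h i j) ⟨
    (∑[ i < n ] ((∑[ j < n ] inverted (swap ∘ h) i j) xor (∑[ j < n ] inverted h i j)))
      ≡⟨ sum-cong-≗ (λ i → ∑-distrib-+ (inverted (swap ∘ h) i) (inverted h i)) ⟨
    (∑[ i < n ] ∑[ j < n ] (inverted (swap ∘ h) i j xor inverted h i j))
      ≡⟨ sum-cong-≗ (λ i → sum-cong-≗ (inverted-swap i)) ⟩
    (∑[ i < n ] ∑[ j < n ] (((j =ᵇ p) ∧ ((i =ᵇ q) ∧ (i <ᶠ j))) xor ((j =ᵇ q) ∧ ((i =ᵇ p) ∧ (i <ᶠ j)))))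
      ≡⟨ sum-cong-≗ (λ i → trans (∑-distrib-+ (λ j → (j =ᵇ p) ∧ ((i =ᵇ q) ∧ (i <ᶠ j))) _)
                                  (cong₂ _xor_ (∑-point p _) (∑-point q _))) ⟩
    (∑[ i < n ] (((i =ᵇ q) ∧ (i <ᶠ p)) xor ((i =ᵇ p) ∧ (i <ᶠ q))))
      ≡⟨ trans (∑-distrib-+ (λ i → (i =ᵇ q) ∧ (i <ᶠ p)) _) (cong₂ _xor_ (∑-point q _) (∑-point p _)) ⟩
    (q <ᶠ p) xor (p <ᶠ q)
      ≡⟨ comparable ⟩
    true ∎)
    where
    open ≡-Reasoning
    xor≡true⇒≡not : ∀ {a b} → a xor b ≡ true → a ≡ not b
    xor≡true⇒≡not {true}  {true}  ()
    xor≡true⇒≡not {true}  {false} _ = refl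
    xor≡true⇒≡not {false} {true}  _ = refl
    xor≡true⇒≡not {false} {false} ()
    comparable : (q <ᶠ p) xor (p <ᶠ q) ≡ true
    comparable with <-cmp (toℕ p) (toℕ q)
    ... | tri< p<q _ q≮p rewrite dec-false (toℕ q <? toℕ p) q≮p | dec-true (toℕ p <? toℕ q) p<q = refl
    ... | tri≈ _ p≡q _ = ⊥-elim (<-irrefl (trans (sym hp) (trans (cong (toℕ ∘ h) (toℕ-injective p≡q)) hq)) (n<1+n k))
    ... | tri> p≮q _ q<p rewrite dec-true (toℕ q <? toℕ p) q<p | dec-false (toℕ p <? toℕ q) p≮q = refl

-- The cycle on [L, L + d] is a product of d adjacent transpositions.
inversionParity-cycUp : ∀ {n L H} (H≤n : H ≤ n) d → H ≡ suc (d + L) → ∀ {h : Fin n → Fin n} → Invertible h →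
  inversionParity (cycUp L H H≤n ∘ h) ≡ parity d xor inversionParity h
inversionParity-cycUp {L = L} H≤n zero refl {h} _ = inversionParity-cong λ i →
  toℕ-injective (trans (toℕ-cycUp L (suc L) H≤n (h i)) (rotate⁺-trivial L (toℕ (h i))))
inversionParity-cycUp {n} {L} H≤n (suc d) refl {h} h-inv = begin
  inversionParity (cycUp L (2 + k) H≤n ∘ h)      ≡⟨ inversionParity-cong (λ i → toℕ-injective (split (h i))) ⟩
  inversionParity (cycUp L (suc k) k+1≤n ∘ swap ∘ h)
    ≡⟨ inversionParity-cycUp k+1≤n d refl (invertible-∘ (cycUp-invertible k (2 + k) H≤n) h-inv) ⟩
  parity d xor inversionParity (swap ∘ h)
    ≡⟨ cong (parity d xor_) (inversionParity-swap (invertible-injective h-inv) H≤n (proj₂ p) (proj₂ q)) ⟩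
  parity d xor not (inversionParity h)       ≡⟨ not-distribʳ-xor (parity d) _ ⟨
  not (parity d xor inversionParity h)       ≡⟨ not-distribˡ-xor (parity d) _ ⟩
  parity (suc d) xor inversionParity h       ∎
  where
  open ≡-Reasoning
  k = d + L
  k+1≤n : suc k ≤ n
  k+1≤n = ≤-trans (n≤1+n _) H≤n
  swap = cycUp k (2 + k) H≤n
  p = preimage h-inv {k} (≤-trans (n≤1+n _) H≤n)
  q = preimage h-inv {suc k} H≤n
  split : ∀ y → toℕ (cycUp L (2 + k) H≤n y) ≡ toℕ (cycUp L (suc k) k+1≤n (swap y))
  split y = begin
    toℕ (cycUp L (2 + k) H≤n y)                      ≡⟨ toℕ-cycUp L (2 + k) H≤n y ⟩
    rotate⁺ L (2 + k) (toℕ y)                        ≡⟨ rotate⁺-split (toℕ y) (m≤n+m L d) (m<n⇒m<1+n (n<1+n k)) ⟩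
    rotate⁺ L (suc k) (rotate⁺ k (2 + k) (toℕ y))    ≡⟨ cong (rotate⁺ L (suc k)) (toℕ-cycUp k (2 + k) H≤n y) ⟨
    rotate⁺ L (suc k) (toℕ (swap y))                 ≡⟨ toℕ-cycUp L (suc k) k+1≤n (swap y) ⟨
    toℕ (cycUp L (suc k) k+1≤n (swap y))             ∎

inversionParity-cycDown : ∀ {n L H} (H≤n : H ≤ n) d → H ≡ suc (d + L) → ∀ {h : Fin n → Fin n} → Invertible h →
  inversionParity (cycDown L H H≤n ∘ h) ≡ parity d xor inversionParity h
inversionParity-cycDown {L = L} {H} H≤n d H≡ {h} h-inv = xor-transpose {parity d} (begin
  inversionParity h
    ≡⟨ inversionParity-cong (λ i → cycUp-cycDown L H H≤n (h i)) ⟨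
  inversionParity (cycUp L H H≤n ∘ cycDown L H H≤n ∘ h)
    ≡⟨ inversionParity-cycUp H≤n d H≡ (invertible-∘ (cycDown-invertible L H H≤n) h-inv) ⟩
  parity d xor inversionParity (cycDown L H H≤n ∘ h) ∎)
  where
  open ≡-Reasoning
  xor-transpose : ∀ {a b c} → b ≡ a xor c → c ≡ a xor b
  xor-transpose {true}  {c = c} refl = sym (not-involutive c)
  xor-transpose {false}         refl = refl

FixesBelow : ∀ {n} → ℕ → (Fin n → Fin n) → Set
FixesBelow i h = ∀ x → toℕ x < i → h x ≡ x

module _ {n : ℕ} {h : Fin n → Fin n} where

  fixesBelow-≥ : Invertible h → ∀ {i} → FixesBelow i h → ∀ x → i ≤ toℕ x → i ≤ toℕ (h x)
  fixesBelow-≥ h-inv {i} fixes x i≤x with toℕ (h x) <? i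
  ... | no hx≮i = ≮⇒≥ hx≮i
  ... | yes hx<i = ⊥-elim (<⇒≱ (subst (λ y → toℕ y < i) hx≡x hx<i) i≤x)
    where hx≡x = invertible-injective h-inv (fixes (h x) hx<i)

  fixesBelow-suc : ∀ {i} → FixesBelow i h → (∀ x → toℕ x ≡ i → toℕ (h x) ≡ i) → FixesBelow (suc i) h
  fixesBelow-suc fixes fixes-i x x<i+1 with m≤n⇒m<n∨m≡n (≤-pred x<i+1)
  ... | inj₁ x<i = fixes x x<i
  ... | inj₂ x≡i = toℕ-injective (trans (fixes-i x x≡i) (sym x≡i))

fixesBelow-∘ : ∀ {n i} {f g : Fin n → Fin n} → FixesBelow i f → FixesBelow i g → FixesBelow i (f ∘ g)
fixesBelow-∘ {f = f} f-fixes g-fixes x x<i = trans (cong f (g-fixes x x<i)) (f-fixes x x<i)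

fixesBelow-mono : ∀ {n i j} {h : Fin n → Fin n} → i ≤ j → FixesBelow j h → FixesBelow i h
fixesBelow-mono i≤j fixes x x<i = fixes x (<-≤-trans x<i i≤j)

fixesBelow-last : ∀ {m} {h : Fin (suc m) → Fin (suc m)} → Invertible h → FixesBelow m h → ∀ x → h x ≡ x
fixesBelow-last {m} {h} h-inv fixes x = fixesBelow-suc fixes last-fixed x (toℕ<n x)
  where
  last-fixed : ∀ x → toℕ x ≡ m → toℕ (h x) ≡ m
  last-fixed x x≡m = ≤-antisym (≤-pred (toℕ<n (h x))) (fixesBelow-≥ h-inv fixes x (≤-reflexive (sym x≡m)))

-- The last two points are either fixed or swapped, and a swap is odd.
even-fixesBelow-two : ∀ {n} {h : Fin n → Fin n} → Invertible h → FixesBelow (n ∸ 2) h →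
  inversionParity h ≡ false → ∀ x → h x ≡ x
even-fixesBelow-two {zero}        h-inv fixes even ()
even-fixesBelow-two {suc zero}    h-inv fixes even = fixesBelow-last h-inv fixes
even-fixesBelow-two {suc (suc m)} {h} h-inv fixes even = fixesBelow-last h-inv (fixesBelow-suc fixes fixes-m)
  where
  swap : Fin (2 + m) → Fin (2 + m)
  swap = cycUp m (2 + m) ≤-refl

  swap-fixesBelow : FixesBelow m (swap ∘ h)
  swap-fixesBelow y y<m = trans (cong swap (fixes y y<m))
    (toℕ-injective (trans (toℕ-cycUp m (2 + m) ≤-refl y) (rotate⁺-below y<m)))

  fixes-m : ∀ x → toℕ x ≡ m → toℕ (h x) ≡ m
  fixes-m x x≡m with toℕ (h x) ≟ m
  ... | yes hx≡m = hx≡m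
  ... | no hx≢m = ⊥-elim (true≢false (begin
    true                                ≡⟨ cong not even ⟨
    not (inversionParity h)             ≡⟨ inversionParity-cycUp {L = m} ≤-refl 1 refl h-inv ⟨
    inversionParity (swap ∘ h)
      ≡⟨ inversionParity-cong (fixesBelow-last swap∘h-inv (fixesBelow-suc swap-fixesBelow swap-fixes-m)) ⟩
    inversionParity {2 + m} id          ≡⟨ inversionParity-id {2 + m} ⟩
    false                               ∎))
    where
    open ≡-Reasoning
    true≢false : true ≢ false
    true≢false ()
    swap∘h-inv = invertible-∘ (cycUp-invertible m (2 + m) ≤-refl) h-inv
    hx≡m+1 : toℕ (h x) ≡ suc m
    hx≡m+1 = ≤-antisym (≤-pred (toℕ<n (h x)))
                       (≤∧≢⇒< (fixesBelow-≥ h-inv fixes x (≤-reflexive (sym x≡m))) (hx≢m ∘ sym))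
    swap-fixes-m : ∀ y → toℕ y ≡ m → toℕ (swap (h y)) ≡ m
    swap-fixes-m y y≡m rewrite toℕ-injective {i = y} {x} (trans y≡m (sym x≡m)) = begin
      toℕ (swap (h x))            ≡⟨ toℕ-cycUp m (2 + m) ≤-refl (h x) ⟩
      rotate⁺ m (2 + m) (toℕ (h x)) ≡⟨ cong (rotate⁺ m (2 + m)) hx≡m+1 ⟩
      rotate⁺ m (2 + m) (suc m)   ≡⟨ swap-second m ⟩
      m                           ∎

module _ {A : Set} where

  _^_ : (A → A) → ℕ → A → A
  (f ^ zero)  x = x
  (f ^ suc k) x = f ((f ^ k) x)

  ^-cong : ∀ {f g : A → A} → f ≗ g → ∀ k → f ^ k ≗ g ^ k
  ^-cong         f≗g zero    x = refl
  ^-cong {f} {g} f≗g (suc k) x = trans (f≗g _) (cong g (^-cong f≗g k x))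

  ^-commute : ∀ {f g : A → A} → f ∘ g ≗ g ∘ f → ∀ k → (f ^ k) ∘ g ≗ g ∘ (f ^ k)
  ^-commute         fg≗gf zero    x = refl
  ^-commute {f} {g} fg≗gf (suc k) x = trans (cong f (^-commute {f} {g} fg≗gf k x)) (fg≗gf _)

  ^-comm : ∀ (f : A → A) j k → (f ^ j) ∘ (f ^ k) ≗ (f ^ k) ∘ (f ^ j)
  ^-comm f j k = ^-commute {f} {f ^ k} (λ x → sym (^-commute {f} {f} (λ _ → refl) k x)) j

  ^-suc : ∀ (f : A → A) k x → (f ^ suc k) x ≡ (f ^ k) (f x)
  ^-suc f zero    x = refl
  ^-suc f (suc k) x = cong f (^-suc f k x)

  ^-cancel : ∀ {f g : A → A} → g ∘ f ≗ id → ∀ k → (g ^ k) ∘ (f ^ k) ≗ id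
  ^-cancel         gf≗id zero    x = refl
  ^-cancel {f} {g} gf≗id (suc k) x = begin
    (g ^ suc k) ((f ^ suc k) x)  ≡⟨ ^-suc g k _ ⟩
    (g ^ k) (g (f ((f ^ k) x)))  ≡⟨ cong (g ^ k) (gf≗id _) ⟩
    (g ^ k) ((f ^ k) x)          ≡⟨ ^-cancel {f} {g} gf≗id k x ⟩
    x                            ∎
    where open ≡-Reasoning

  ^-conjugate : ∀ {f g t : A → A} → g ∘ f ≗ id → f ∘ g ≗ id → ∀ m → (g ∘ t ∘ f) ^ m ≗ g ∘ (t ^ m) ∘ f
  ^-conjugate gf≗id fg≗id zero    x = sym (gf≗id x)
  ^-conjugate {f} {g} {t} gf≗id fg≗id (suc m) x =
    cong (g ∘ t) (trans (cong f (^-conjugate {f} {g} {t} gf≗id fg≗id m x)) (fg≗id _))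

-- Words of shifts

inverseMove : Move → Move
inverseMove α⁺ = α⁻
inverseMove α⁻ = α⁺
inverseMove β⁺ = β⁻
inverseMove β⁻ = β⁺

inverseWord : List Move → List Move
inverseWord []       = []
inverseWord (m ∷ w) = inverseWord w ++ inverseMove m ∷ []

length-inverseWord : ∀ w → length (inverseWord w) ≡ length w
length-inverseWord []      = refl
length-inverseWord (m ∷ w) = trans (length-++ (inverseWord w)) (trans (+-comm _ 1) (cong suc (length-inverseWord w)))

repeat : ∀ {A : Set} → ℕ → List A → List A
repeat zero    w = []
repeat (suc k) w = w ++ repeat k w

length-repeat : ∀ {A : Set} k (w : List A) → length (repeat k w) ≡ k * length w
length-repeat zero    w = refl
length-repeat (suc k) w = trans (length-++ w) (cong (length w +_) (length-repeat k w))

module Puzzle (c d : ℕ) where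

  a b n : ℕ
  a = 2 + c
  b = 2 + d
  n = a + b ∸ 1

  2≤b : 2 ≤ b
  2≤b = s≤s (s≤s z≤n)

  IsCycle : ℕ → ℕ → (Fin n → Fin n) → Set
  IsCycle lo hi f = ∀ x → toℕ (f x) ≡ rotate⁺ lo hi (toℕ x)

  isCycle-unique : ∀ {lo hi f g} → IsCycle lo hi f → IsCycle lo hi g → f ≗ g
  isCycle-unique f-cyc g-cyc x = toℕ-injective (trans (f-cyc x) (sym (g-cyc x)))

  isCycle-subst : ∀ {lo hi lo′ hi′ f} → lo ≡ lo′ → hi ≡ hi′ → IsCycle lo hi f → IsCycle lo′ hi′ f
  isCycle-subst refl refl f-cyc = f-cyc

  n≡3+c+d : n ≡ 3 + (c + d)
  n≡3+c+d = cong suc (trans (+-suc c (suc d)) (cong suc (+-suc c d)))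

  a≤n : a ≤ n
  a≤n = subst (a ≤_) (sym n≡3+c+d) (s≤s (s≤s (≤-trans (m≤m+n c d) (n≤1+n _))))

  c+3≤n : 3 + c ≤ n
  c+3≤n = subst (3 + c ≤_) (sym n≡3+c+d) (s≤s (s≤s (s≤s (m≤m+n c d))))

  rotation : Move → ℕ → ℕ
  rotation α⁺ = rotate⁺ 0 a
  rotation α⁻ = rotate⁻ 0 a
  rotation β⁺ = rotate⁺ (suc c) n
  rotation β⁻ = rotate⁻ (suc c) n

  -- Opaque, so that goals about words are never unfolded into nested cycUp and cycDown terms.
  opaque
    shift : Move → Fin n → Fin n
    shift = move a b 2≤b

    ⟦_⟧ : List Move → Fin n → Fin n
    ⟦_⟧ = evalWord a b 2≤b

    evalWord≗⟦⟧ : ∀ w → evalWord a b 2≤b w ≗ ⟦ w ⟧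
    evalWord≗⟦⟧ w x = refl

    ⟦⟧-[] : ∀ x → ⟦ [] ⟧ x ≡ x
    ⟦⟧-[] x = refl

    ⟦⟧-∷ : ∀ m w x → ⟦ m ∷ w ⟧ x ≡ shift m (⟦ w ⟧ x)
    ⟦⟧-∷ m w x = refl

    toℕ-shift : ∀ m x → toℕ (shift m x) ≡ rotation m (toℕ x)
    toℕ-shift α⁺ = toℕ-cycUp 0 a _
    toℕ-shift α⁻ = toℕ-cycDown 0 a _
    toℕ-shift β⁺ = toℕ-cycUp (suc c) n _
    toℕ-shift β⁻ = toℕ-cycDown (suc c) n _

    shift-inverseMove : ∀ m x → shift m (shift (inverseMove m) x) ≡ x
    shift-inverseMove α⁺ = cycUp-cycDown 0 a _
    shift-inverseMove α⁻ = cycDown-cycUp 0 a _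
    shift-inverseMove β⁺ = cycUp-cycDown (suc c) n _
    shift-inverseMove β⁻ = cycDown-cycUp (suc c) n _

    inverseMove-shift : ∀ m x → shift (inverseMove m) (shift m x) ≡ x
    inverseMove-shift α⁺ = cycDown-cycUp 0 a _
    inverseMove-shift α⁻ = cycUp-cycDown 0 a _
    inverseMove-shift β⁺ = cycDown-cycUp (suc c) n _
    inverseMove-shift β⁻ = cycUp-cycDown (suc c) n _

  rotations : List Move → ℕ → ℕ
  rotations []      = id
  rotations (m ∷ w) = rotation m ∘ rotations w

  toℕ-⟦⟧ : ∀ w x → toℕ (⟦ w ⟧ x) ≡ rotations w (toℕ x)
  toℕ-⟦⟧ []      x = cong toℕ (⟦⟧-[] x)
  toℕ-⟦⟧ (m ∷ w) x = trans (cong toℕ (⟦⟧-∷ m w x)) (trans (toℕ-shift m _) (cong (rotation m) (toℕ-⟦⟧ w x)))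

  ⟦⟧-++ : ∀ u v x → ⟦ u ++ v ⟧ x ≡ ⟦ u ⟧ (⟦ v ⟧ x)
  ⟦⟧-++ []      v x = sym (⟦⟧-[] _)
  ⟦⟧-++ (m ∷ u) v x = trans (⟦⟧-∷ m (u ++ v) x) (trans (cong (shift m) (⟦⟧-++ u v x)) (sym (⟦⟧-∷ m u _)))

  ⟦⟧-single : ∀ m x → ⟦ m ∷ [] ⟧ x ≡ shift m x
  ⟦⟧-single m x = trans (⟦⟧-∷ m [] x) (cong (shift m) (⟦⟧-[] x))

  ⟦inverseWord⟧-left : ∀ w x → ⟦ inverseWord w ⟧ (⟦ w ⟧ x) ≡ x
  ⟦inverseWord⟧-left []      x = trans (⟦⟧-[] _) (⟦⟧-[] x)
  ⟦inverseWord⟧-left (m ∷ w) x = begin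
    ⟦ inverseWord w ++ inverseMove m ∷ [] ⟧ (⟦ m ∷ w ⟧ x)  ≡⟨ ⟦⟧-++ (inverseWord w) _ _ ⟩
    ⟦ inverseWord w ⟧ (⟦ inverseMove m ∷ [] ⟧ (⟦ m ∷ w ⟧ x))
      ≡⟨ cong ⟦ inverseWord w ⟧ (trans (⟦⟧-single _ _) (cong (shift (inverseMove m)) (⟦⟧-∷ m w x))) ⟩
    ⟦ inverseWord w ⟧ (shift (inverseMove m) (shift m (⟦ w ⟧ x)))
      ≡⟨ cong ⟦ inverseWord w ⟧ (inverseMove-shift m _) ⟩
    ⟦ inverseWord w ⟧ (⟦ w ⟧ x)                            ≡⟨ ⟦inverseWord⟧-left w x ⟩
    x                                                      ∎
    where open ≡-Reasoning

  ⟦inverseWord⟧-right : ∀ w x → ⟦ w ⟧ (⟦ inverseWord w ⟧ x) ≡ x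
  ⟦inverseWord⟧-right []      x = trans (⟦⟧-[] _) (⟦⟧-[] x)
  ⟦inverseWord⟧-right (m ∷ w) x = begin
    ⟦ m ∷ w ⟧ (⟦ inverseWord w ++ inverseMove m ∷ [] ⟧ x)
      ≡⟨ ⟦⟧-∷ m w _ ⟩
    shift m (⟦ w ⟧ (⟦ inverseWord w ++ inverseMove m ∷ [] ⟧ x))
      ≡⟨ cong (shift m ∘ ⟦ w ⟧) (trans (⟦⟧-++ (inverseWord w) _ _) (cong ⟦ inverseWord w ⟧ (⟦⟧-single _ x))) ⟩
    shift m (⟦ w ⟧ (⟦ inverseWord w ⟧ (shift (inverseMove m) x)))
      ≡⟨ cong (shift m) (⟦inverseWord⟧-right w _) ⟩
    shift m (shift (inverseMove m) x)                      ≡⟨ shift-inverseMove m x ⟩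
    x                                                      ∎
    where open ≡-Reasoning

  ⟦⟧-invertible : ∀ w → Invertible ⟦ w ⟧
  ⟦⟧-invertible w = ⟦ inverseWord w ⟧ , ⟦inverseWord⟧-right w , ⟦inverseWord⟧-left w

  ⟦repeat⟧ : ∀ k w → ⟦ repeat k w ⟧ ≗ ⟦ w ⟧ ^ k
  ⟦repeat⟧ zero    w x = ⟦⟧-[] x
  ⟦repeat⟧ (suc k) w x = trans (⟦⟧-++ w _ x) (cong ⟦ w ⟧ (⟦repeat⟧ k w x))

  σ σ⁻¹ : List Move
  σ   = α⁺ ∷ β⁺ ∷ []
  σ⁻¹ = inverseWord σ

  σᵏ σ⁻ᵏ : ℕ → Fin n → Fin n
  σᵏ k  = ⟦ σ ⟧ ^ k
  σ⁻ᵏ k = ⟦ σ⁻¹ ⟧ ^ k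

  σ⁻ᵏ-σᵏ : ∀ k x → σ⁻ᵏ k (σᵏ k x) ≡ x
  σ⁻ᵏ-σᵏ = ^-cancel (⟦inverseWord⟧-left σ)

  σᵏ-σ⁻ᵏ : ∀ k x → σᵏ k (σ⁻ᵏ k x) ≡ x
  σᵏ-σ⁻ᵏ = ^-cancel (⟦inverseWord⟧-right σ)

  σ-isCycle : IsCycle 0 n ⟦ σ ⟧
  σ-isCycle x = trans (toℕ-⟦⟧ σ x) (rotate⁺-join (toℕ x) a≤n (toℕ<n x))

  σ-intertwines : ∀ k {lo hi C} → IsCycle lo hi C → k + hi ≤ n →
    ∀ x → toℕ (σᵏ k (C x)) ≡ rotate⁺ (k + lo) (k + hi) (toℕ (σᵏ k x))
  σ-intertwines zero    C-cyc k+hi≤n x = C-cyc x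
  σ-intertwines (suc k) {lo} {hi} {C} C-cyc k+hi≤n x = begin
    toℕ (σᵏ (suc k) (C x))
      ≡⟨ σ-isCycle _ ⟩
    rotate⁺ 0 n (toℕ (σᵏ k (C x)))
      ≡⟨ cong (rotate⁺ 0 n) (σ-intertwines k C-cyc (≤-trans (n≤1+n _) k+hi≤n) x) ⟩
    rotate⁺ 0 n (rotate⁺ (k + lo) (k + hi) (toℕ (σᵏ k x)))
      ≡⟨ rotate⁺-full-shift _ k+hi≤n (toℕ<n _) ⟩
    rotate⁺ (suc k + lo) (suc k + hi) (rotate⁺ 0 n (toℕ (σᵏ k x)))
      ≡⟨ cong (rotate⁺ (suc k + lo) (suc k + hi)) (σ-isCycle _) ⟨
    rotate⁺ (suc k + lo) (suc k + hi) (toℕ (σᵏ (suc k) x)) ∎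
    where open ≡-Reasoning

  σ-conjugate : ∀ k {lo hi C} → IsCycle lo hi C → k + hi ≤ n →
    IsCycle (k + lo) (k + hi) (σᵏ k ∘ C ∘ σ⁻ᵏ k)
  σ-conjugate k {lo} {hi} C-cyc k+hi≤n x =
    trans (σ-intertwines k C-cyc k+hi≤n _)
          (cong (rotate⁺ (k + lo) (k + hi) ∘ toℕ) (σᵏ-σ⁻ᵏ k x))

  γ : List Move
  γ = β⁺ ∷ α⁻ ∷ β⁻ ∷ α⁺ ∷ []

  γ-isCycle : IsCycle c (3 + c) ⟦ γ ⟧
  γ-isCycle x = trans (toℕ-⟦⟧ γ x) (rotate⁺-commutator c (toℕ x) c+3≤n (toℕ<n x))
  G : Fin n → Fin n
  G = σ⁻ᵏ c ∘ ⟦ γ ⟧ ∘ σᵏ c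

  G-isCycle : IsCycle 0 3 G
  G-isCycle x = begin
    toℕ (σ⁻ᵏ c (⟦ γ ⟧ (σᵏ c x)))
      ≡⟨ cong (toℕ ∘ σ⁻ᵏ c) (isCycle-unique γ-isCycle shifted (σᵏ c x)) ⟩
    toℕ (σ⁻ᵏ c (σᵏ c (C₃ (σ⁻ᵏ c (σᵏ c x)))))      ≡⟨ cong toℕ (σ⁻ᵏ-σᵏ c _) ⟩
    toℕ (C₃ (σ⁻ᵏ c (σᵏ c x)))                     ≡⟨ cong (toℕ ∘ C₃) (σ⁻ᵏ-σᵏ c x) ⟩
    toℕ (C₃ x)                                    ≡⟨ toℕ-cycUp 0 3 3≤n x ⟩
    rotate⁺ 0 3 (toℕ x)                           ∎
    where
    open ≡-Reasoning
    3≤n = ≤-trans (m≤m+n 3 c) c+3≤n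
    C₃ = cycUp 0 3 3≤n
    shifted : IsCycle c (3 + c) (σᵏ c ∘ C₃ ∘ σ⁻ᵏ c)
    shifted = isCycle-subst (+-identityʳ c) (+-comm c 3)
                (σ-conjugate c (toℕ-cycUp 0 3 3≤n) (subst (_≤ n) (+-comm 3 c) c+3≤n))

  -- (G σ²)ᵐ σ⁻²ᵐ is the product of the 3-cycles on [0, 2], [2, 4], …, [2m - 2, 2m], conjugates of G.
  Gσ²-power : ∀ m → suc (double m) ≤ n →
    ∀ x → toℕ (((G ∘ σᵏ 2) ^ m) x) ≡ rotate⁺ 0 (suc (double m)) (toℕ (σᵏ (double m) x))
  Gσ²-power zero    _ x = sym (rotate⁺-trivial 0 (toℕ x))
  Gσ²-power (suc m) 2m+3≤n x = begin
    toℕ (G (σᵏ 2 y))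
      ≡⟨ G-isCycle _ ⟩
    rotate⁺ 0 3 (toℕ (σᵏ 2 y))
      ≡⟨ cong (rotate⁺ 0 3) (trans (σ-isCycle _) (cong (rotate⁺ 0 n) (σ-isCycle y))) ⟩
    rotate⁺ 0 3 (rotate⁺ 0 n (rotate⁺ 0 n (toℕ y)))
      ≡⟨ cong (rotate⁺ 0 3 ∘ rotate⁺ 0 n ∘ rotate⁺ 0 n) (Gσ²-power m 2m+1≤n x) ⟩
    rotate⁺ 0 3 (rotate⁺ 0 n (rotate⁺ 0 n (rotate⁺ 0 (suc (double m)) z)))
      ≡⟨ cong (rotate⁺ 0 3 ∘ rotate⁺ 0 n) (rotate⁺-full-shift z (≤-trans (n≤1+n _) 2m+3≤n) (toℕ<n _)) ⟩
    rotate⁺ 0 3 (rotate⁺ 0 n (rotate⁺ 1 (2 + double m) (rotate⁺ 0 n z)))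
      ≡⟨ cong (rotate⁺ 0 3) (rotate⁺-full-shift (rotate⁺ 0 n z) 2m+3≤n σz<n) ⟩
    rotate⁺ 0 3 (rotate⁺ 2 (3 + double m) (rotate⁺ 0 n (rotate⁺ 0 n z)))
      ≡⟨ rotate⁺-split _ z≤n (s≤s (s≤s (s≤s z≤n))) ⟨
    rotate⁺ 0 (3 + double m) (rotate⁺ 0 n (rotate⁺ 0 n z))
      ≡⟨ cong (rotate⁺ 0 (3 + double m)) (trans (σ-isCycle _) (cong (rotate⁺ 0 n) (σ-isCycle _))) ⟨
    rotate⁺ 0 (3 + double m) (toℕ (σᵏ 2 (σᵏ (double m) x))) ∎
    where
    open ≡-Reasoning
    y = ((G ∘ σᵏ 2) ^ m) x
    z = toℕ (σᵏ (double m) x)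
    2m+1≤n = ≤-trans (n≤1+n _) (≤-trans (n≤1+n _) 2m+3≤n)
    σz<n : rotate⁺ 0 n z < n
    σz<n = subst (_< n) (σ-isCycle _) (toℕ<n (⟦ σ ⟧ (σᵏ (double m) x)))

  κ : List Move
  κ = γ ++ σ ++ σ

  -- The conjugation by σᶜ sits outside the power, so the length is linear in c + m.
  spiral : ℕ → List Move
  spiral m = repeat c σ⁻¹ ++ repeat m κ ++ repeat c σ

  ⟦spiral⟧ : ∀ m → ⟦ spiral m ⟧ ≗ (G ∘ σᵏ 2) ^ m
  ⟦spiral⟧ m x = begin
    ⟦ spiral m ⟧ x
      ≡⟨ ⟦⟧-++ (repeat c σ⁻¹) _ x ⟩
    ⟦ repeat c σ⁻¹ ⟧ (⟦ repeat m κ ++ repeat c σ ⟧ x)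
      ≡⟨ ⟦repeat⟧ c σ⁻¹ _ ⟩
    σ⁻ᵏ c (⟦ repeat m κ ++ repeat c σ ⟧ x)
      ≡⟨ cong (σ⁻ᵏ c) (trans (⟦⟧-++ (repeat m κ) _ x)
                            (trans (⟦repeat⟧ m κ _) (cong (⟦ κ ⟧ ^ m) (⟦repeat⟧ c σ x)))) ⟩
    σ⁻ᵏ c ((⟦ κ ⟧ ^ m) (σᵏ c x))
      ≡⟨ ^-conjugate {f = σᵏ c} {σ⁻ᵏ c} {⟦ κ ⟧} (σ⁻ᵏ-σᵏ c) (σᵏ-σ⁻ᵏ c) m x ⟨
    ((σ⁻ᵏ c ∘ ⟦ κ ⟧ ∘ σᵏ c) ^ m) x
      ≡⟨ ^-cong conjugated-κ m x ⟩
    ((G ∘ σᵏ 2) ^ m) x ∎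
    where
    open ≡-Reasoning
    conjugated-κ : σ⁻ᵏ c ∘ ⟦ κ ⟧ ∘ σᵏ c ≗ G ∘ σᵏ 2
    conjugated-κ y = cong (σ⁻ᵏ c) (begin
      ⟦ γ ++ σ ++ σ ⟧ (σᵏ c y)            ≡⟨ trans (⟦⟧-++ γ _ _) (cong ⟦ γ ⟧ (⟦⟧-++ σ σ _)) ⟩
      ⟦ γ ⟧ (σᵏ 2 (σᵏ c y))               ≡⟨ cong ⟦ γ ⟧ (^-comm ⟦ σ ⟧ 2 c y) ⟩
      ⟦ γ ⟧ (σᵏ c (σᵏ 2 y))               ∎)

  oddCycle : ℕ → ℕ → List Move
  oddCycle L m = repeat L σ ++ spiral m ++ repeat (double m) σ⁻¹ ++ repeat L σ⁻¹

  oddCycle-isCycle : ∀ L m → L + suc (double m) ≤ n → IsCycle L (L + suc (double m)) ⟦ oddCycle L m ⟧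
  oddCycle-isCycle L m L+2m+1≤n x = begin
    toℕ (⟦ oddCycle L m ⟧ x)
      ≡⟨ cong toℕ (evaluate x) ⟩
    toℕ (σᵏ L (C (σ⁻ᵏ L x)))
      ≡⟨ isCycle-subst (+-identityʳ L) refl (σ-conjugate L C-isCycle L+2m+1≤n) x ⟩
    rotate⁺ L (L + suc (double m)) (toℕ x) ∎
    where
    open ≡-Reasoning
    C : Fin n → Fin n
    C = ⟦ spiral m ⟧ ∘ σ⁻ᵏ (double m)
    C-isCycle : IsCycle 0 (suc (double m)) C
    C-isCycle y = begin
      toℕ (⟦ spiral m ⟧ (σ⁻ᵏ (double m) y))
        ≡⟨ cong toℕ (⟦spiral⟧ m _) ⟩
      toℕ (((G ∘ σᵏ 2) ^ m) (σ⁻ᵏ (double m) y))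
        ≡⟨ Gσ²-power m (≤-trans (m≤n+m _ L) L+2m+1≤n) _ ⟩
      rotate⁺ 0 (suc (double m)) (toℕ (σᵏ (double m) (σ⁻ᵏ (double m) y)))
        ≡⟨ cong (rotate⁺ 0 (suc (double m)) ∘ toℕ) (σᵏ-σ⁻ᵏ (double m) y) ⟩
      rotate⁺ 0 (suc (double m)) (toℕ y) ∎
    evaluate : ∀ y → ⟦ oddCycle L m ⟧ y ≡ σᵏ L (C (σ⁻ᵏ L y))
    evaluate y = begin
      ⟦ oddCycle L m ⟧ y
        ≡⟨ ⟦⟧-++ (repeat L σ) _ y ⟩
      ⟦ repeat L σ ⟧ (⟦ spiral m ++ repeat (double m) σ⁻¹ ++ repeat L σ⁻¹ ⟧ y)
        ≡⟨ ⟦repeat⟧ L σ _ ⟩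
      σᵏ L (⟦ spiral m ++ repeat (double m) σ⁻¹ ++ repeat L σ⁻¹ ⟧ y)
        ≡⟨ cong (σᵏ L) (⟦⟧-++ (spiral m) _ y) ⟩
      σᵏ L (⟦ spiral m ⟧ (⟦ repeat (double m) σ⁻¹ ++ repeat L σ⁻¹ ⟧ y))
        ≡⟨ cong (σᵏ L ∘ ⟦ spiral m ⟧) (⟦⟧-++ (repeat (double m) σ⁻¹) _ y) ⟩
      σᵏ L (⟦ spiral m ⟧ (⟦ repeat (double m) σ⁻¹ ⟧ (⟦ repeat L σ⁻¹ ⟧ y)))
        ≡⟨ cong (σᵏ L ∘ ⟦ spiral m ⟧)
                (trans (⟦repeat⟧ (double m) σ⁻¹ _) (cong (σ⁻ᵏ (double m)) (⟦repeat⟧ L σ⁻¹ y))) ⟩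
      σᵏ L (C (σ⁻ᵏ L y)) ∎

  length-oddCycle : ∀ L m → L + suc (double m) ≤ n → length (oddCycle L m) ≤ 18 * n
  length-oddCycle L m L+2m+1≤n = begin
    length (oddCycle L m)
      ≡⟨ exact-length ⟩
    L * 2 + ((c * 2 + (m * 8 + c * 2)) + (double m * 2 + L * 2))
      ≤⟨ +-mono-≤ (*-monoˡ-≤ 2 L≤n)
                  (+-mono-≤ (+-mono-≤ (*-monoˡ-≤ 2 c≤n) (+-mono-≤ (*-monoˡ-≤ 8 m≤n) (*-monoˡ-≤ 2 c≤n)))
                                                (+-mono-≤ (*-monoˡ-≤ 2 2m≤n) (*-monoˡ-≤ 2 L≤n))) ⟩
    n * 2 + ((n * 2 + (n * 8 + n * 2)) + (n * 2 + n * 2))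
      ≡⟨ arithmetic n ⟩
    18 * n ∎
    where
    open ≤-Reasoning
    arithmetic : ∀ x → x * 2 + ((x * 2 + (x * 8 + x * 2)) + (x * 2 + x * 2)) ≡ 18 * x
    arithmetic = solve-∀
    exact-length : length (oddCycle L m) ≡ L * 2 + ((c * 2 + (m * 8 + c * 2)) + (double m * 2 + L * 2))
    exact-length
      rewrite length-++ (repeat L σ) {spiral m ++ repeat (double m) σ⁻¹ ++ repeat L σ⁻¹}
            | length-++ (spiral m) {repeat (double m) σ⁻¹ ++ repeat L σ⁻¹}
            | length-++ (repeat c σ⁻¹) {repeat m κ ++ repeat c σ}
            | length-++ (repeat m κ) {repeat c σ}
            | length-++ (repeat (double m) σ⁻¹) {repeat L σ⁻¹}
            | length-repeat L σ | length-repeat c σ⁻¹ | length-repeat m κ | length-repeat c σ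
            | length-repeat (double m) σ⁻¹ | length-repeat L σ⁻¹ = refl
    L≤n : L ≤ n
    L≤n = ≤-trans (m≤m+n L _) L+2m+1≤n
    2m≤n : double m ≤ n
    2m≤n = ≤-trans (n≤1+n _) (≤-trans (m≤n+m _ L) L+2m+1≤n)
    m≤n : m ≤ n
    m≤n = ≤-trans (m≤double m) 2m≤n
      where
      m≤double : ∀ m → m ≤ double m
      m≤double zero    = z≤n
      m≤double (suc m) = s≤s (≤-trans (m≤double m) (n≤1+n _))
    c≤n : c ≤ n
    c≤n = ≤-trans (m≤n+m c 3) c+3≤n

-- Sorting an even permutation

module Sorting (c d : ℕ) where

  open Puzzle c d

  module _ {lo hi : ℕ} {w : List Move} (hi≤n : hi ≤ n) (w-cyc : IsCycle lo hi ⟦ w ⟧) where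

    ⟦⟧≗cycUp : ⟦ w ⟧ ≗ cycUp lo hi hi≤n
    ⟦⟧≗cycUp = isCycle-unique w-cyc (toℕ-cycUp lo hi hi≤n)

    ⟦inverseWord⟧≗cycDown : ⟦ inverseWord w ⟧ ≗ cycDown lo hi hi≤n
    ⟦inverseWord⟧≗cycDown x = begin
      ⟦ inverseWord w ⟧ x                                            ≡⟨ cycDown-cycUp lo hi hi≤n _ ⟨
      cycDown lo hi hi≤n (cycUp lo hi hi≤n (⟦ inverseWord w ⟧ x))    ≡⟨ cong (cycDown lo hi hi≤n) (⟦⟧≗cycUp _) ⟨
      cycDown lo hi hi≤n (⟦ w ⟧ (⟦ inverseWord w ⟧ x))               ≡⟨ cong (cycDown lo hi hi≤n) (⟦inverseWord⟧-right w x) ⟩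
      cycDown lo hi hi≤n x                                           ∎
      where open ≡-Reasoning

    ⟦⟧-fixesBelow : FixesBelow lo ⟦ w ⟧
    ⟦⟧-fixesBelow x x<lo = toℕ-injective (trans (w-cyc x) (rotate⁺-below x<lo))

    ⟦inverseWord⟧-fixesBelow : FixesBelow lo ⟦ inverseWord w ⟧
    ⟦inverseWord⟧-fixesBelow x x<lo =
      trans (⟦inverseWord⟧≗cycDown x) (toℕ-injective (trans (toℕ-cycDown lo hi hi≤n x) (rotate⁻-below x<lo)))

  module _ {L m : ℕ} (bound : L + suc (double m) ≤ n) {h : Fin n → Fin n} (h-inv : Invertible h) where

    private
      length≡ : L + suc (double m) ≡ suc (double m + L)
      length≡ = trans (+-suc L (double m)) (cong suc (+-comm L (double m)))
      cyc = oddCycle-isCycle L m bound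

    inversionParity-oddCycle : inversionParity (⟦ oddCycle L m ⟧ ∘ h) ≡ inversionParity h
    inversionParity-oddCycle = begin
      inversionParity (⟦ oddCycle L m ⟧ ∘ h)                   ≡⟨ inversionParity-cong (⟦⟧≗cycUp bound cyc ∘ h) ⟩
      inversionParity (cycUp L (L + suc (double m)) bound ∘ h) ≡⟨ inversionParity-cycUp bound (double m) length≡ h-inv ⟩
      parity (double m) xor inversionParity h                  ≡⟨ cong (_xor inversionParity h) (parity-double m) ⟩
      inversionParity h                                        ∎
      where open ≡-Reasoning

    inversionParity-oddCycle⁻¹ : inversionParity (⟦ inverseWord (oddCycle L m) ⟧ ∘ h) ≡ inversionParity h
    inversionParity-oddCycle⁻¹ = begin
      inversionParity (⟦ inverseWord (oddCycle L m) ⟧ ∘ h)       ≡⟨ inversionParity-cong (⟦inverseWord⟧≗cycDown bound cyc ∘ h) ⟩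
      inversionParity (cycDown L (L + suc (double m)) bound ∘ h) ≡⟨ inversionParity-cycDown bound (double m) length≡ h-inv ⟩
      parity (double m) xor inversionParity h                    ≡⟨ cong (_xor inversionParity h) (parity-double m) ⟩
      inversionParity h                                          ∎
      where open ≡-Reasoning

  record Placement (i : ℕ) (h : Fin n → Fin n) : Set where
    field
      word             : List Move
      length-word      : length word ≤ 36 * n
      fixes            : FixesBelow (suc i) (⟦ word ⟧ ∘ h)
      parity-preserved : inversionParity (⟦ word ⟧ ∘ h) ≡ inversionParity h

  module _ {i : ℕ} {h : Fin n → Fin n} (h-inv : Invertible h) (h-fixes : FixesBelow i h)
           (p : Fin n) (p≡i : toℕ p ≡ i) where

    private
      j = toℕ (h p)

      i≤j : i ≤ j
      i≤j = fixesBelow-≥ h-inv h-fixes p (≤-reflexive (sym p≡i))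

      settle : ∀ {f} → FixesBelow i f → toℕ (f (h p)) ≡ i → FixesBelow (suc i) (f ∘ h)
      settle {f} f-fixes fhp≡i = fixesBelow-suc (fixesBelow-∘ f-fixes h-fixes) λ x x≡i →
        subst (λ y → toℕ (f (h y)) ≡ i) (toℕ-injective (trans p≡i (sym x≡i))) fhp≡i

      36n-bound : ∀ {k} → k ≤ 18 * n → k ≤ 36 * n
      36n-bound k≤18n = ≤-trans k≤18n (*-monoˡ-≤ n {18} {36} (m≤m+n 18 18))

    placeEven : ∀ m → j ≡ i + double m → Placement i h
    placeEven m j≡i+2m = record
      { word             = oddCycle i m
      ; length-word      = 36n-bound (length-oddCycle i m bound)
      ; fixes            = settle (⟦⟧-fixesBelow bound cyc) (begin
          toℕ (⟦ oddCycle i m ⟧ (h p))          ≡⟨ cyc (h p) ⟩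
          rotate⁺ i (i + suc (double m)) j     ≡⟨ rotate⁺-last i≤j j+1≡ ⟩
          i                                    ∎)
      ; parity-preserved = inversionParity-oddCycle bound h-inv
      }
      where
      open ≡-Reasoning
      j+1≡ : suc j ≡ i + suc (double m)
      j+1≡ = trans (cong suc j≡i+2m) (sym (+-suc i (double m)))
      bound : i + suc (double m) ≤ n
      bound = subst (_≤ n) j+1≡ (toℕ<n (h p))
      cyc = oddCycle-isCycle i m bound

    -- The cycle on [i + 1, j] takes j to i + 1, then the inverse 3-cycle on [i, i + 2] takes it to i.
    placeOdd : ∀ m → j ≡ i + suc (double m) → 3 + i ≤ n → Placement i h
    placeOdd m j≡i+2m+1 i+3≤n = record
      { word             = B ++ A
      ; length-word      = length-B++A
      ; fixes            = settle B++A-fixes B++A-settles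
      ; parity-preserved = B++A-parity
      }
      where
      A B : List Move
      A = oddCycle (suc i) m
      B = inverseWord (oddCycle i 1)
      A-bound : suc i + suc (double m) ≤ n
      A-bound = subst (_≤ n) (cong suc j≡i+2m+1) (toℕ<n (h p))
      B-bound : i + 3 ≤ n
      B-bound = subst (_≤ n) (+-comm 3 i) i+3≤n
      A-cyc = oddCycle-isCycle (suc i) m A-bound
      B-cyc = oddCycle-isCycle i 1 B-bound
      i<j : suc i ≤ j
      i<j = subst (suc i ≤_) (sym j≡i+2m+1) (≤-trans (s≤s (m≤m+n i (double m))) (≤-reflexive (sym (+-suc i (double m)))))
      i+1<i+3 : suc i < i + 3
      i+1<i+3 = subst (suc i <_) (+-comm 3 i) (s≤s (n≤1+n _))
      B++A-fixes : FixesBelow i ⟦ B ++ A ⟧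
      B++A-fixes x x<i = trans (⟦⟧-++ B A x)
        (fixesBelow-∘ (⟦inverseWord⟧-fixesBelow B-bound B-cyc) (fixesBelow-mono (n≤1+n i) (⟦⟧-fixesBelow A-bound A-cyc)) x x<i)
      length-B++A : length (B ++ A) ≤ 36 * n
      length-B++A = begin
        length (B ++ A)                      ≡⟨ length-++ B ⟩
        length B + length A                  ≡⟨ cong (_+ length A) (length-inverseWord (oddCycle i 1)) ⟩
        length (oddCycle i 1) + length A     ≤⟨ +-mono-≤ (length-oddCycle i 1 B-bound) (length-oddCycle (suc i) m A-bound) ⟩
        18 * n + 18 * n                      ≡⟨ *-distribʳ-+ n 18 18 ⟨
        36 * n                               ∎
        where open ≤-Reasoning
      B++A-settles : toℕ (⟦ B ++ A ⟧ (h p)) ≡ i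
      B++A-settles = begin
        toℕ (⟦ B ++ A ⟧ (h p))                               ≡⟨ cong toℕ (⟦⟧-++ B A (h p)) ⟩
        toℕ (⟦ B ⟧ (⟦ A ⟧ (h p)))                            ≡⟨ cong toℕ (⟦inverseWord⟧≗cycDown B-bound B-cyc _) ⟩
        toℕ (cycDown i (i + 3) B-bound (⟦ A ⟧ (h p)))        ≡⟨ toℕ-cycDown i (i + 3) B-bound _ ⟩
        rotate⁻ i (i + 3) (toℕ (⟦ A ⟧ (h p)))                ≡⟨ cong (rotate⁻ i (i + 3)) (A-cyc (h p)) ⟩
        rotate⁻ i (i + 3) (rotate⁺ (suc i) (suc i + suc (double m)) j)
          ≡⟨ cong (rotate⁻ i (i + 3)) (rotate⁺-last i<j (cong suc j≡i+2m+1)) ⟩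
        rotate⁻ i (i + 3) (suc i)                            ≡⟨ rotate⁻-inner (n<1+n i) i+1<i+3 ⟩
        i                                                    ∎
        where open ≡-Reasoning
      B++A-parity : inversionParity (⟦ B ++ A ⟧ ∘ h) ≡ inversionParity h
      B++A-parity = begin
        inversionParity (⟦ B ++ A ⟧ ∘ h)           ≡⟨ inversionParity-cong (λ x → ⟦⟧-++ B A (h x)) ⟩
        inversionParity (⟦ B ⟧ ∘ ⟦ A ⟧ ∘ h)        ≡⟨ inversionParity-oddCycle⁻¹ B-bound (invertible-∘ (⟦⟧-invertible A) h-inv) ⟩
        inversionParity (⟦ A ⟧ ∘ h)                ≡⟨ inversionParity-oddCycle A-bound h-inv ⟩
        inversionParity h                          ∎
        where open ≡-Reasoning

  place : ∀ i {h} → Invertible h → FixesBelow i h → 3 + i ≤ n → Placement i h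
  place i {h} h-inv fixes i+3≤n = placeAt (fromℕ< i<n) (toℕ-fromℕ< i<n)
    where
    i<n : i < n
    i<n = ≤-trans (m≤n+m (suc i) 2) i+3≤n
    from-difference : ∀ {p t} → toℕ p ≡ i → toℕ (h p) ∸ i ≡ t → toℕ (h p) ≡ i + t
    from-difference {p} p≡i j∸i≡t =
      trans (sym (m+[n∸m]≡n (fixesBelow-≥ h-inv fixes p (≤-reflexive (sym p≡i))))) (cong (i +_) j∸i≡t)
    placeAt : ∀ p → toℕ p ≡ i → Placement i h
    placeAt p p≡i with halve (toℕ (h p) ∸ i)
    ... | m , inj₁ j∸i≡2m   = placeEven h-inv fixes p p≡i m (from-difference p≡i j∸i≡2m)
    ... | m , inj₂ j∸i≡2m+1 = placeOdd h-inv fixes p p≡i m (from-difference p≡i j∸i≡2m+1) i+3≤n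

  GeneratedIn : ℕ → (Fin n → Fin n) → Set
  GeneratedIn N h = Σ (List Move) λ w → length w ≤ N × ⟦ w ⟧ ≗ h

  generatedIn-∘ : ∀ {K N w₀ h} → length w₀ ≤ K → GeneratedIn N (⟦ w₀ ⟧ ∘ h) → GeneratedIn (K + N) h
  generatedIn-∘ {K} {N} {w₀} {h} |w₀|≤K (w , |w|≤N , ⟦w⟧≗) = inverseWord w₀ ++ w , length-≤ , correct
    where
    length-≤ : length (inverseWord w₀ ++ w) ≤ K + N
    length-≤ = begin
      length (inverseWord w₀ ++ w)          ≡⟨ length-++ (inverseWord w₀) ⟩
      length (inverseWord w₀) + length w    ≡⟨ cong (_+ length w) (length-inverseWord w₀) ⟩
      length w₀ + length w                  ≤⟨ +-mono-≤ |w₀|≤K |w|≤N ⟩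
      K + N                                 ∎
      where open ≤-Reasoning
    correct : ⟦ inverseWord w₀ ++ w ⟧ ≗ h
    correct x = begin
      ⟦ inverseWord w₀ ++ w ⟧ x              ≡⟨ ⟦⟧-++ (inverseWord w₀) w x ⟩
      ⟦ inverseWord w₀ ⟧ (⟦ w ⟧ x)           ≡⟨ cong ⟦ inverseWord w₀ ⟧ (⟦w⟧≗ x) ⟩
      ⟦ inverseWord w₀ ⟧ (⟦ w₀ ⟧ (h x))      ≡⟨ ⟦inverseWord⟧-left w₀ (h x) ⟩
      h x                                    ∎
      where open ≡-Reasoning

  sort : ∀ f i {h} → Invertible h → FixesBelow i h → inversionParity h ≡ false → n ≤ f + (2 + i) →
    GeneratedIn (f * (36 * n)) h
  sort f i h-inv fixes even n≤f+i+2 with 3 + i ≤? n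
  ... | no i+3≰n = [] , z≤n , λ x → trans (⟦⟧-[] x) (sym (even-fixesBelow-two h-inv (fixesBelow-mono n∸2≤i fixes) even x))
    where n∸2≤i = m≤n+o⇒m∸n≤o n 2 (≤-pred (≰⇒> i+3≰n))
  sort zero    i h-inv fixes even n≤i+2 | yes i+3≤n = ⊥-elim (<-irrefl refl (≤-trans i+3≤n n≤i+2))
  sort (suc f) i h-inv fixes even n≤f+i+3 | yes i+3≤n =
    generatedIn-∘ length-word (sort f (suc i) (invertible-∘ (⟦⟧-invertible word) h-inv) settled
                                 (trans parity-preserved even) (subst (n ≤_) (sym (+-suc f (2 + i))) n≤f+i+3))
    where
    open Placement (place i h-inv fixes i+3≤n) renaming (fixes to settled)

odd⇒parity-pred≡false : ∀ m → Odd (suc m) → parity m ≡ false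
odd⇒parity-pred≡false m odd = trans (sym (not-involutive (parity m))) (even⇒parity≡false odd)

¬odd⇒parity-pred≡true : ∀ m → ¬ Odd (suc m) → parity m ≡ true
¬odd⇒parity-pred≡true m ¬odd with parity m in eq
... | true  = refl
... | false = ⊥-elim (¬odd (parity≡false⇒even (suc (suc m)) (trans (not-involutive (parity m)) eq)))

module Configuration (c d : ℕ) where

  open Puzzle c d
  open Sorting c d

  moveParity : Move → Bool
  moveParity α⁺ = parity (suc c)
  moveParity α⁻ = parity (suc c)
  moveParity β⁺ = parity (suc d)
  moveParity β⁻ = parity (suc d)

  shift-α⁺ : shift α⁺ ≗ cycUp 0 a a≤n
  shift-α⁺ x = toℕ-injective (trans (toℕ-shift α⁺ x) (sym (toℕ-cycUp 0 a a≤n x)))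

  shift-α⁻ : shift α⁻ ≗ cycDown 0 a a≤n
  shift-α⁻ x = toℕ-injective (trans (toℕ-shift α⁻ x) (sym (toℕ-cycDown 0 a a≤n x)))

  shift-β⁺ : shift β⁺ ≗ cycUp (suc c) n ≤-refl
  shift-β⁺ x = toℕ-injective (trans (toℕ-shift β⁺ x) (sym (toℕ-cycUp (suc c) n ≤-refl x)))

  shift-β⁻ : shift β⁻ ≗ cycDown (suc c) n ≤-refl
  shift-β⁻ x = toℕ-injective (trans (toℕ-shift β⁻ x) (sym (toℕ-cycDown (suc c) n ≤-refl x)))

  α-length : a ≡ suc (suc c + 0)
  α-length = cong (2 +_) (sym (+-identityʳ c))

  β-length : n ≡ suc (suc d + suc c)
  β-length = cong suc (trans (+-comm c (2 + d)) (sym (+-suc (suc d) c)))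

  inversionParity-shift : ∀ m {h : Fin n → Fin n} → Invertible h →
    inversionParity (shift m ∘ h) ≡ moveParity m xor inversionParity h
  inversionParity-shift α⁺ {h} h-inv =
    trans (inversionParity-cong {h′ = cycUp 0 a a≤n ∘ h} (shift-α⁺ ∘ h))
          (inversionParity-cycUp a≤n (suc c) α-length h-inv)
  inversionParity-shift α⁻ {h} h-inv =
    trans (inversionParity-cong {h′ = cycDown 0 a a≤n ∘ h} (shift-α⁻ ∘ h))
          (inversionParity-cycDown a≤n (suc c) α-length h-inv)
  inversionParity-shift β⁺ {h} h-inv =
    trans (inversionParity-cong {h′ = cycUp (suc c) n ≤-refl ∘ h} (shift-β⁺ ∘ h))
          (inversionParity-cycUp ≤-refl (suc d) β-length h-inv)
  inversionParity-shift β⁻ {h} h-inv =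
    trans (inversionParity-cong {h′ = cycDown (suc c) n ≤-refl ∘ h} (shift-β⁻ ∘ h))
          (inversionParity-cycDown ≤-refl (suc d) β-length h-inv)

  inversionParity-word : parity (suc c) ≡ false → parity (suc d) ≡ false → ∀ w → inversionParity ⟦ w ⟧ ≡ false
  inversionParity-word even-α even-β []      = trans (inversionParity-cong ⟦⟧-[]) (inversionParity-id {n})
  inversionParity-word even-α even-β (m ∷ w) = begin
    inversionParity ⟦ m ∷ w ⟧                  ≡⟨ inversionParity-cong (⟦⟧-∷ m w) ⟩
    inversionParity (shift m ∘ ⟦ w ⟧)          ≡⟨ inversionParity-shift m (⟦⟧-invertible w) ⟩
    moveParity m xor inversionParity ⟦ w ⟧     ≡⟨ cong₂ _xor_ (even-move m) (inversionParity-word even-α even-β w) ⟩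
    false                                      ∎
    where
    open ≡-Reasoning
    even-move : ∀ m → moveParity m ≡ false
    even-move α⁺ = even-α
    even-move α⁻ = even-α
    even-move β⁺ = even-β
    even-move β⁻ = even-β

  weaken : ∀ {N M h} → N ≤ M → GeneratedIn N h → GeneratedIn M h
  weaken N≤M (w , |w|≤N , ⟦w⟧≗h) = w , ≤-trans |w|≤N N≤M , ⟦w⟧≗h

  generate-even : ∀ {h} → Invertible h → inversionParity h ≡ false → GeneratedIn (n * (36 * n)) h
  generate-even h-inv even = sort n 0 h-inv (λ _ ()) even (m≤m+n n 2)

  generate-odd : ∀ m {h} → Invertible h → moveParity m ≡ true → inversionParity h ≡ true →
    GeneratedIn (1 + n * (36 * n)) h
  generate-odd m {h} h-inv odd-m odd-h =
    generatedIn-∘ {w₀ = m ∷ []} ≤-refl (generate-even (invertible-∘ (⟦⟧-invertible (m ∷ [])) h-inv) even)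
    where
    even : inversionParity (⟦ m ∷ [] ⟧ ∘ h) ≡ false
    even = trans (inversionParity-cong (⟦⟧-single m ∘ h)) (trans (inversionParity-shift m h-inv) (cong₂ _xor_ odd-m odd-h))

  module _ (π : Permutation′ n) where

    private
      π-invertible : Invertible (π ⟨$⟩ʳ_)
      π-invertible = (π ⟨$⟩ˡ_) , (λ _ → inverseʳ π) , (λ _ → inverseˡ π)

      n*36n≡36n² : n * (36 * n) ≡ 36 * (n * n)
      n*36n≡36n² = trans (*-comm n (36 * n)) (*-assoc 36 n n)

      even-bound : n * (36 * n) ≤ 37 * (n * n)
      even-bound = ≤-trans (≤-reflexive n*36n≡36n²) (m≤n+m _ (n * n))

      odd-bound : 1 + n * (36 * n) ≤ 37 * (n * n)
      odd-bound = +-mono-≤ (s≤s z≤n) (≤-reflexive n*36n≡36n²)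

    even-if-generated : InGroup a b 2≤b π → Odd a × Odd b → IsEven π
    even-if-generated (_ , w , _ , w≗π) (odd-a , odd-b) = parity≡false⇒even (inversions π) (begin
      parity (inversions π)               ≡⟨ parity-inversions π ⟩
      inversionParity (π ⟨$⟩ʳ_)           ≡⟨ inversionParity-cong (λ x → trans (sym (w≗π x)) (evalWord≗⟦⟧ w x)) ⟩
      inversionParity ⟦ w ⟧
        ≡⟨ inversionParity-word (odd⇒parity-pred≡false (suc c) odd-a) (odd⇒parity-pred≡false (suc d) odd-b) w ⟩
      false                               ∎)
      where open ≡-Reasoning

    generate : (Odd a × Odd b → IsEven π) → GeneratedIn (37 * (n * n)) (π ⟨$⟩ʳ_)
    generate even-if-odd with inversionParity (π ⟨$⟩ʳ_) in parity-π
    ... | false = weaken even-bound (generate-even π-invertible parity-π)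
    ... | true with 2 ∣? suc a | 2 ∣? suc b
    ...   | no ¬odd-a | _ =
      weaken odd-bound (generate-odd α⁺ π-invertible (¬odd⇒parity-pred≡true (suc c) ¬odd-a) parity-π)
    ...   | yes _ | no ¬odd-b =
      weaken odd-bound (generate-odd β⁺ π-invertible (¬odd⇒parity-pred≡true (suc d) ¬odd-b) parity-π)
    ...   | yes odd-a | yes odd-b = ⊥-elim (true≢false (begin
      true                        ≡⟨ parity-π ⟨
      inversionParity (π ⟨$⟩ʳ_)   ≡⟨ parity-inversions π ⟨
      parity (inversions π)       ≡⟨ even⇒parity≡false (even-if-odd (odd-a , odd-b)) ⟩
      false                       ∎))
      where
      open ≡-Reasoning
      true≢false : true ≢ false
      true≢false ()

    generatedIn⇒GenIn : ∀ {N} → GeneratedIn N (π ⟨$⟩ʳ_) → GenIn a b 2≤b N π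
    generatedIn⇒GenIn (w , |w|≤N , ⟦w⟧≗π) = w , |w|≤N , λ x → trans (evalWord≗⟦⟧ w x) (⟦w⟧≗π x)

    configurationGroup :
      ((InGroup a b 2≤b π → (Odd a × Odd b → IsEven π)) × ((Odd a × Odd b → IsEven π) → InGroup a b 2≤b π)) ×
      (InGroup a b 2≤b π → GenIn a b 2≤b (37 * (n * n)) π)
    configurationGroup =
      (even-if-generated , λ parity-condition → _ , generatedIn⇒GenIn (generate parity-condition)) ,
      λ generated → generatedIn⇒GenIn (generate (even-if-generated generated))

theorem1 : Σ ℕ λ C → (a b : ℕ) → (ha : 2 ≤ a) → (hb : 2 ≤ b) → (π : Permutation′ (a + b ∸ 1)) → ((InGroup a b hb π → (Odd a × Odd b → IsEven π)) × ((Odd a × Odd b → IsEven π) → InGroup a b hb π)) × (InGroup a b hb π → GenIn a b hb (C * ((a + b ∸ 1) * (a + b ∸ 1))) π)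
theorem1 = 37 , λ where
  _ _ (s≤s (s≤s (z≤n {c}))) (s≤s (s≤s (z≤n {d}))) → Configuration.configurationGroup c d
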